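{- Let $k\ge 1$, $n$, $m$ be integers with $1\le m\le n-k$, and write $n-m=sk+t$ with integers $s\ge 0$ and $0\le t<k$. Let $G$ be a connected simple graph of order $n$ with vertex $k$-partiteness $v_k(G)\le m$. Then $$RDD(G)\le \frac{2n^3-n^2-3mn+2m}{2}-\frac{(n-m)(3n-s-1)s}{2}-\frac{t(s+1)(3n-2s-2)}{2},$$ with equality if and only if $G\cong K_m\vee\big((k-t)\overline{K_s}\vee t\overline{K_{s+1}}\big)$.
   Context: A graph is $k$-partite if its vertex set can be partitioned into $k$ (possibly empty) sets each inducing no edges. The vertex $k$-partiteness $v_k(G)$ is the minimum number of vertices whose deletion from $G$ yields a $k$-partite graph. With $d(x)$ the degree and $d(x,y)$ the shortest-path distance, the reciprocal degree distance is $RDD(G)=\sum_{\{x,y\}\subseteq V(G)}\frac{d(x)+d(y)}{d(x,y)}$ over unordered pairs of distinct vertices. $G_1\vee G_2$ (join) is the disjoint union plus all edges between $V(G_1)$ and $V(G_2)$; $\overline{K_r}$ is the edgeless graph on $r$ vertices; $(k-t)\overline{K_s}\vee t\overline{K_{s+1}}$ is the complete $k$-partite graph with $k-t$ parts of size $s$ and $t$ parts of size $s+1$. -}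

module Defs where

open import Data.Bool using (Bool; true; false; _∧_; _∨_; not; if_then_else_; T)
open import Data.Nat as ℕ using (ℕ; zero; suc; _+_; _*_; _∸_; _≤_; _<_)
open import Data.Integer as ℤ using (ℤ; +_)
open import Data.Fin using (Fin; toℕ; splitAt; _≟_)
open import Data.Fin.Subset using (Subset; _∈_; _∉_; ∣_∣)
open import Data.List using (List; map; foldr; allFin; upTo)
open import Data.Nat.ListAction using (sum)
open import Data.Bool.ListAction using (any)
open import Data.Rational as ℚ using (ℚ; 0ℚ; _/_)
open import Data.Sum using (inj₁; inj₂)
open import Data.Product using (Σ; ∃; _×_)
open import Relation.Nullary.Decidable using (⌊_⌋)
open import Relation.Binary.PropositionalEquality using (_≡_; _≢_)
open import Function.Bundles using (_⤖_; Bijection)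

record Graph (n : ℕ) : Set where
  constructor graph
  field adj : Fin n → Fin n → Bool
open Graph public

Simple : ∀ {n} → Graph n → Set
Simple {n} G = (∀ x y → adj G x y ≡ adj G y x) × (∀ x → adj G x x ≡ false)

data Walk {n} (G : Graph n) : Fin n → Fin n → ℕ → Set where
  here : ∀ x → Walk G x x 0
  step : ∀ {x y z ℓ} → T (adj G x y) → Walk G y z ℓ → Walk G x z (suc ℓ)

Connected : ∀ {n} → Graph n → Set
Connected {n} G = ∀ (x y : Fin n) → ∃ λ ℓ → Walk G x y ℓ

deg : ∀ {n} → Graph n → Fin n → ℕ
deg {n} G x = sum (map (λ y → if adj G x y then 1 else 0) (allFin n))

reach : ∀ {n} → Graph n → ℕ → Fin n → Fin n → Bool
reach G zero x y = ⌊ x ≟ y ⌋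
reach {n} G (suc ℓ) x y =
  reach G ℓ x y ∨ any (λ z → adj G x z ∧ reach G ℓ z y) (allFin n)

-- Shortest-path distance: the least ℓ with reach G ℓ x y (reach is monotone in ℓ),
-- computed as the number of ℓ < n for which y is not yet reached within ℓ steps.
-- For a connected graph on n vertices this is exactly d(x,y).
dist : ∀ {n} → Graph n → Fin n → Fin n → ℕ
dist {n} G x y = sum (map (λ ℓ → if reach G ℓ x y then 0 else 1) (upTo n))

-- a / d as a rational (d = 0 never occurs for distinct vertices of a connected graph)
frac : ℕ → ℕ → ℚ
frac a zero = 0ℚ
frac a (suc d) = (+ a) / suc d

sumℚ : List ℚ → ℚ
sumℚ = foldr ℚ._+_ 0ℚ

RDD : ∀ {n} → Graph n → ℚ
RDD {n} G = sumℚ (map (λ x → sumℚ (map (λ y →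
    if ⌊ toℕ x ℕ.<? toℕ y ⌋ then frac (deg G x + deg G y) (dist G x y) else 0ℚ)
  (allFin n))) (allFin n))

-- v_k(G) ≤ m : deleting some set S of at most m vertices leaves a k-partite graph,
-- i.e. the remaining vertices admit a partition into k classes (colouring Fin n → Fin k
-- restricted to V∖S) with no edge inside a class.
VkAtMost : ∀ {n} (k m : ℕ) → Graph n → Set
VkAtMost {n} k m G = Σ (Subset n) λ S → (∣ S ∣ ≤ m) × Σ (Fin n → Fin k) λ c →
  ∀ x y → x ∉ S → y ∉ S → T (adj G x y) → c x ≢ c y

K : (r : ℕ) → Graph r
K r = graph λ x y → not ⌊ x ≟ y ⌋

edgeless : (r : ℕ) → Graph r
edgeless r = graph λ _ _ → false

join : ∀ {a b} → Graph a → Graph b → Graph (a + b)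
join {a} G H = graph λ x y → go (splitAt a x) (splitAt a y)
  where
  go : _ → _ → Bool
  go (inj₁ u) (inj₁ v) = adj G u v
  go (inj₂ u) (inj₂ v) = adj H u v
  go (inj₁ _) (inj₂ _) = true
  go (inj₂ _) (inj₁ _) = true

-- r G : join of r copies of G
joinPow : ∀ {a} (r : ℕ) → Graph a → Graph (r * a)
joinPow zero G = edgeless 0
joinPow (suc r) G = join G (joinPow r G)

record _≅_ {a b} (G : Graph a) (H : Graph b) : Set where
  field
    bij : Fin a ⤖ Fin b
    preserves : ∀ x y → adj H (Bijection.to bij x) (Bijection.to bij y) ≡ adj G x y

extremal : (m k s t : ℕ) → Graph (m + ((k ∸ t) * s + t * suc s))
extremal m k s t = join (K m) (join (joinPow (k ∸ t) (edgeless s)) (joinPow t (edgeless (suc s))))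

bound : (n m s t : ℕ) → ℚ
bound n m s t = num / 2
  where
  N M S T' : ℤ
  N = + n
  M = + m
  S = + s
  T' = + t
  num : ℤ
  num = (+ 2) ℤ.* N ℤ.* N ℤ.* N ℤ.- N ℤ.* N ℤ.- (+ 3) ℤ.* M ℤ.* N ℤ.+ (+ 2) ℤ.* M
        ℤ.- (N ℤ.- M) ℤ.* ((+ 3) ℤ.* N ℤ.- S ℤ.- (+ 1)) ℤ.* S
        ℤ.- T' ℤ.* (S ℤ.+ (+ 1)) ℤ.* ((+ 3) ℤ.* N ℤ.- (+ 2) ℤ.* S ℤ.- (+ 2))

-- Every term (d(x) + d(y))/d(x,y) of RDD is at most (d(x) + d(y))/1 for adjacent and
-- (d(x) + d(y))/2 for non-adjacent pairs, with equality when the diameter is at most 2; summing,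
-- 2·RDD(G) ≤ Σ_x h(d(x)) with h(d) = (n − 1)d + d². Deleting at most m vertices leaves a k-partite
-- graph; a deleted vertex has degree at most n − 1 and a vertex in a part of size a at most n − a, so
-- 2·RDD(G) ≤ m′h(n − 1) + Σ_i a_i h(n − a_i) where m′ ≤ m vertices are deleted and Σ a_i = n − m′.
-- Comparing the cubic a ↦ a·h(n − a) with its chord through s and s + 1 shows that 2·bound exceeds
-- this by (m − m′)·s(6n − 3s − 5) + Σ_i (a_i − s)(a_i − s − 1)(3n − 2 − 2s − a_i), a sum of
-- non-negative terms. Equality therefore forces m′ = m, every a_i ∈ {s, s + 1} and every allowed edge
-- to be present, i.e. G ≅ K_m ∨ ((k − t)K̄_s ∨ tK̄_{s+1}); conversely that graph has a dominating
-- vertex, so its diameter is at most 2 and all the inequalities above are equalities.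

module Submission where

open import Defs
open import Data.Nat using (ℕ; zero; suc; _+_; _*_; _∸_; _≤_; _<_; _<?_; z≤n; s≤s)
import Data.Nat.Properties as ℕP
import Data.Nat.ListAction as List
open import Data.Fin as Fin using (Fin; zero; suc; toℕ; splitAt; punchIn; quotient; _↑ˡ_; _↑ʳ_; _≟_)
import Data.Fin.Properties as FinP
open import Data.Fin.Permutation as Perm using (Permutation; _⟨$⟩ʳ_; _⟨$⟩ˡ_)
open import Data.Fin.Subset using (Subset; _∉_; ∣_∣)
open import Data.Bool using (Bool; true; false; not; _∧_; _∨_; if_then_else_; T)
open import Data.Bool.Properties as BoolP using (∨-zeroʳ; ∧-zeroʳ; ∧-identityʳ)
open import Data.Bool.ListAction using (any)
open import Data.Maybe as Maybe using (Maybe; just; nothing)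
import Data.Maybe.Properties as MaybeP
open import Data.Product using (Σ; ∃; _×_; _,_; proj₁; proj₂)
open import Data.Sum using (_⊎_; inj₁; inj₂; [_,_]′; map₁)
import Data.Sum.Properties as SumP
open import Data.Empty using (⊥-elim)
open import Data.List using ([]; _∷_; map; tabulate; allFin; applyUpTo)
open import Data.List.Properties using (map-tabulate; tabulate-cong)
open import Data.List.Membership.Propositional using (_∈_)
open import Data.List.Membership.Propositional.Properties using (∈-allFin)
open import Data.List.Relation.Unary.Any using (here; there)
open import Data.Vec using ([]; _∷_; lookup)
open import Data.Vec.Properties using ([]=⇒lookup)
open import Data.Rational as ℚ using (ℚ; 0ℚ) renaming (_≤_ to _≤ℚ_)
import Data.Rational.Properties as ℚP
open import Algebra.Properties.Semiring.Sum ℕP.+-*-semiring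
  using (sum; sum-cong-≗; ∑-distrib-+; ∑-comm; sum-remove; sum-permute; *-distribʳ-sum)
open import Function using (_∘_)
open import Function.Bundles using (_⇔_; mk⇔; Bijection)
open import Function.Properties.Bijection using (⤖⇒↔)
open import Function.Properties.Inverse using (↔⇒⤖)
open import Relation.Nullary using (¬_; Dec; yes; no)
open import Relation.Nullary.Decidable using (⌊_⌋; ⌊⌋-map′)
open import Relation.Binary.Definitions using (DecidableEquality)
open import Relation.Binary.PropositionalEquality

ind : Bool → ℕ
ind b = if b then 1 else 0

⌊⌋-true : ∀ {a} {A : Set a} (a? : Dec A) → A → ⌊ a? ⌋ ≡ true
⌊⌋-true (yes _) _ = refl
⌊⌋-true (no ¬a) a = ⊥-elim (¬a a)

⌊⌋-false : ∀ {a} {A : Set a} (a? : Dec A) → ¬ A → ⌊ a? ⌋ ≡ false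
⌊⌋-false (yes a) ¬a = ⊥-elim (¬a a)
⌊⌋-false (no _) _ = refl

⌊⌋-sound : ∀ {a} {A : Set a} (a? : Dec A) → ⌊ a? ⌋ ≡ true → A
⌊⌋-sound (yes a) _ = a

⌊≟⌋-injective : ∀ {A B : Set} (_≟ᴬ_ : DecidableEquality A) (_≟ᴮ_ : DecidableEquality B) {f : A → B} →
  (∀ {x y} → f x ≡ f y → x ≡ y) → ∀ x y → ⌊ f x ≟ᴮ f y ⌋ ≡ ⌊ x ≟ᴬ y ⌋
⌊≟⌋-injective _≟ᴬ_ _≟ᴮ_ {f} f-inj x y with x ≟ᴬ y
... | yes refl = ⌊⌋-true (f x ≟ᴮ f x) refl
... | no x≢y = ⌊⌋-false (f x ≟ᴮ f y) (λ fx≡fy → x≢y (f-inj fx≡fy))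

⌊≟⌋-sym : ∀ {n} (x y : Fin n) → ⌊ x ≟ y ⌋ ≡ ⌊ y ≟ x ⌋
⌊≟⌋-sym x y with x ≟ y
... | yes refl = sym (⌊⌋-true (y ≟ y) refl)
... | no x≢y = sym (⌊⌋-false (y ≟ x) (λ y≡x → x≢y (sym y≡x)))

_≟⊎_ : ∀ {a b} → DecidableEquality (Fin a ⊎ Fin b)
_≟⊎_ = SumP.≡-dec _≟_ _≟_

⌊≟⌋-splitAt : ∀ a {b} (u v : Fin (a + b)) → ⌊ u ≟ v ⌋ ≡ ⌊ splitAt a u ≟⊎ splitAt a v ⌋
⌊≟⌋-splitAt a {b} u v = sym (⌊≟⌋-injective _≟_ _≟⊎_ splitAt-injective u v)
  where
  splitAt-injective : ∀ {u v} → splitAt a u ≡ splitAt a v → u ≡ v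
  splitAt-injective {u} {v} eq =
    trans (sym (FinP.join-splitAt a b u)) (trans (cong (Fin.join a b) eq) (FinP.join-splitAt a b v))

ind-not : ∀ b → ind (not b) + ind b ≡ 1
ind-not true = refl
ind-not false = refl

ind-injective : ∀ {b c} → ind b ≡ ind c → b ≡ c
ind-injective {true} {true} _ = refl
ind-injective {false} {false} _ = refl

ind-pos : ∀ {b} → 0 < ind b → b ≡ true
ind-pos {true} _ = refl

two-valued : ∀ {a s} → a ≡ s ⊎ a ≡ suc s → a ≡ s + ind ⌊ a ℕP.≟ suc s ⌋
two-valued {s = s} (inj₁ refl) = trans (sym (ℕP.+-identityʳ s))
  (cong (λ b → s + ind b) (sym (⌊⌋-false (s ℕP.≟ suc s) (ℕP.<⇒≢ (ℕP.n<1+n s)))))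
two-valued {s = s} (inj₂ refl) = trans (ℕP.+-comm 1 s) (cong (λ b → s + ind b) (sym (⌊⌋-true (suc s ℕP.≟ suc s) refl)))

double-injective : ∀ {u v} → u + u ≡ v + v → u ≡ v
double-injective {u} {v} e = ℕP.*-cancelˡ-≡ u v 2
  (trans (cong (u +_) (ℕP.+-identityʳ u)) (trans e (cong (v +_) (sym (ℕP.+-identityʳ v)))))

sum-const : ∀ n c → sum {n} (λ _ → c) ≡ n * c
sum-const zero c = refl
sum-const (suc n) c = cong (c +_) (sum-const n c)

sum-zero : ∀ n → sum {n} (λ _ → 0) ≡ 0
sum-zero n = trans (sum-const n 0) (ℕP.*-zeroʳ n)

sum-*ʳ : ∀ {n} c (f : Fin n → ℕ) → sum (λ i → f i * c) ≡ sum f * c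
sum-*ʳ c f = sym (*-distribʳ-sum c f)

sum-mono-≤ : ∀ {n} {f g : Fin n → ℕ} → (∀ i → f i ≤ g i) → sum f ≤ sum g
sum-mono-≤ {zero} f≤g = z≤n
sum-mono-≤ {suc n} f≤g = ℕP.+-mono-≤ (f≤g zero) (sum-mono-≤ (λ i → f≤g (suc i)))

sum-mono-≤-≡⇒≡ : ∀ {n} {f g : Fin n → ℕ} → (∀ i → f i ≤ g i) → sum f ≡ sum g → ∀ i → f i ≡ g i
sum-mono-≤-≡⇒≡ {suc n} {f} {g} f≤g Σf≡Σg i with ℕP.m≤n⇒m<n∨m≡n (f≤g zero)
... | inj₁ f₀<g₀ = ⊥-elim (ℕP.<⇒≢ (ℕP.+-mono-<-≤ f₀<g₀ (sum-mono-≤ (λ j → f≤g (suc j)))) Σf≡Σg)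
sum-mono-≤-≡⇒≡ f≤g Σf≡Σg zero    | inj₂ f₀≡g₀ = f₀≡g₀
sum-mono-≤-≡⇒≡ {suc n} {f} {g} f≤g Σf≡Σg (suc i) | inj₂ f₀≡g₀ =
  sum-mono-≤-≡⇒≡ (λ j → f≤g (suc j)) (ℕP.+-cancelˡ-≡ (f zero) _ _ (trans Σf≡Σg (cong (_+ _) (sym f₀≡g₀)))) i

sum≡0⇒≡0 : ∀ {n} (f : Fin n → ℕ) → sum f ≡ 0 → ∀ i → f i ≡ 0
sum≡0⇒≡0 {n} f Σf≡0 i =
  sym (sum-mono-≤-≡⇒≡ (λ _ → z≤n) (trans (sum-const n 0) (trans (ℕP.*-zeroʳ n) (sym Σf≡0))) i)

sum-pos⇒∃ : ∀ {n} (f : Fin n → ℕ) → 0 < sum f → ∃ λ i → 0 < f i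
sum-pos⇒∃ {suc n} f 0<Σf with f zero in f₀≡
... | suc _ = zero , subst (0 <_) (sym f₀≡) (s≤s z≤n)
... | zero with sum-pos⇒∃ (λ i → f (suc i)) 0<Σf
...   | i , 0<fi = suc i , 0<fi

sum-single-≤ : ∀ {n} (f : Fin n → ℕ) i → f i ≤ sum f
sum-single-≤ f zero = ℕP.m≤m+n _ _
sum-single-≤ f (suc i) = ℕP.≤-trans (sum-single-≤ (λ j → f (suc j)) i) (ℕP.m≤n+m _ _)

sum-δ : ∀ {n} (j : Fin n) (f : Fin n → ℕ) → sum (λ i → ind ⌊ i ≟ j ⌋ * f i) ≡ f j
sum-δ {suc n} zero f = trans (cong₂ _+_ (ℕP.*-identityˡ (f zero)) (sum-zero n)) (ℕP.+-identityʳ (f zero))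
sum-δ {suc n} (suc j) f = trans
  (sum-cong-≗ (λ i → cong (λ b → ind b * f (suc i)) (⌊⌋-map′ (cong suc) FinP.suc-injective (i ≟ j))))
  (sum-δ j (λ i → f (suc i)))

sum-tabulate : ∀ {n} (f : Fin n → ℕ) → List.sum (tabulate f) ≡ sum f
sum-tabulate {zero} f = refl
sum-tabulate {suc n} f = cong (f zero +_) (sum-tabulate (λ i → f (suc i)))

sum-allFin : ∀ {n} (f : Fin n → ℕ) → List.sum (map f (allFin n)) ≡ sum f
sum-allFin {n} f = trans (cong List.sum (map-tabulate (λ i → i) f)) (sum-tabulate f)

sum-splitAt : ∀ a {b} (F : Fin a ⊎ Fin b → ℕ) →
  sum {a + b} (λ u → F (splitAt a u)) ≡ sum (λ i → F (inj₁ i)) + sum (λ j → F (inj₂ j))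
sum-splitAt zero F = refl
sum-splitAt (suc a) F = trans (cong (F (inj₁ zero) +_) (sum-splitAt a (λ z → F (map₁ suc z))))
  (sym (ℕP.+-assoc (F (inj₁ zero)) _ _))

sum-offDiagonal : ∀ {n} (x : Fin n) → sum (λ y → ind (not ⌊ x ≟ y ⌋)) ≡ n ∸ 1
sum-offDiagonal {n} x = begin
  sum (λ y → ind (not ⌊ x ≟ y ⌋))                  ≡⟨ ℕP.m+n∸n≡m _ 1 ⟨
  sum (λ y → ind (not ⌊ x ≟ y ⌋)) + 1 ∸ 1
      ≡⟨ cong (λ z → sum (λ y → ind (not ⌊ x ≟ y ⌋)) + z ∸ 1) (sym diagonal) ⟩
  sum (λ y → ind (not ⌊ x ≟ y ⌋)) + sum (λ y → ind ⌊ x ≟ y ⌋) ∸ 1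
      ≡⟨ cong (_∸ 1) (sym (∑-distrib-+ (λ y → ind (not ⌊ x ≟ y ⌋)) (λ y → ind ⌊ x ≟ y ⌋))) ⟩
  sum (λ y → ind (not ⌊ x ≟ y ⌋) + ind ⌊ x ≟ y ⌋) ∸ 1
      ≡⟨ cong (_∸ 1) (sum-cong-≗ (λ y → ind-not ⌊ x ≟ y ⌋)) ⟩
  sum {n} (λ _ → 1) ∸ 1                            ≡⟨ cong (_∸ 1) (trans (sum-const n 1) (ℕP.*-identityʳ n)) ⟩
  n ∸ 1                                            ∎
  where
  open ≡-Reasoning
  diagonal : sum (λ y → ind ⌊ x ≟ y ⌋) ≡ 1
  diagonal = trans (sum-cong-≗ (λ y → trans (sym (ℕP.*-identityʳ _)) (cong (λ b → ind b * 1) (⌊≟⌋-sym x y))))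
                   (sum-δ x (λ _ → 1))

sum-symmetric : ∀ {n} (c : Fin n → Fin n → ℕ) (f : Fin n → ℕ) → (∀ x y → c x y ≡ c y x) →
  let T = sum (λ x → sum (c x) * f x) in sum (λ x → sum (λ y → c x y * (f x + f y))) ≡ T + T
sum-symmetric {n} c f c-sym = begin
  sum (λ x → sum (λ y → c x y * (f x + f y)))
    ≡⟨ sum-cong-≗ (λ x → trans (sum-cong-≗ (λ y → ℕP.*-distribˡ-+ (c x y) (f x) (f y)))
                                (∑-distrib-+ (λ y → c x y * f x) (λ y → c x y * f y))) ⟩
  sum (λ x → sum (λ y → c x y * f x) + sum (λ y → c x y * f y))
    ≡⟨ ∑-distrib-+ (λ x → sum (λ y → c x y * f x)) (λ x → sum (λ y → c x y * f y)) ⟩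
  sum (λ x → sum (λ y → c x y * f x)) + sum (λ x → sum (λ y → c x y * f y))
    ≡⟨ cong₂ _+_ (sum-cong-≗ (λ x → sum-*ʳ (f x) (c x))) (∑-comm (λ x y → c x y * f y)) ⟩
  sum (λ x → sum (c x) * f x) + sum (λ y → sum (λ x → c x y * f y))
    ≡⟨ cong (sum (λ x → sum (c x) * f x) +_)
            (sum-cong-≗ (λ y → trans (sum-*ʳ (f y) (λ x → c x y)) (cong (_* f y) (sum-cong-≗ (λ x → c-sym x y))))) ⟩
  sum (λ x → sum (c x) * f x) + sum (λ y → sum (c y) * f y) ∎
  where open ≡-Reasoning

-- Distances

any-≡true : ∀ {A : Set} (p : A → Bool) {z xs} → z ∈ xs → p z ≡ true → any p xs ≡ true
any-≡true p (here refl) pz rewrite pz = refl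
any-≡true p {xs = x ∷ _} (there z∈xs) pz = trans (cong (p x ∨_) (any-≡true p z∈xs pz)) (∨-zeroʳ (p x))

any-≡false : ∀ {A : Set} (p : A → Bool) → (∀ z → p z ≡ false) → ∀ xs → any p xs ≡ false
any-≡false p p≡false [] = refl
any-≡false p p≡false (x ∷ xs) rewrite p≡false x = any-≡false p p≡false xs

if-0-1-cong : ∀ {b c} → b ≡ c → (if b then 0 else 1) ≡ (if c then 0 else 1)
if-0-1-cong = cong (λ b → if b then 0 else 1)

module Distance {n} (G : Graph n) where

  unreached : Fin n → Fin n → ℕ → ℕ
  unreached x y ℓ = if reach G ℓ x y then 0 else 1

  reach-refl : ∀ ℓ y → reach G ℓ y y ≡ true
  reach-refl zero y = ⌊⌋-true (y ≟ y) refl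
  reach-refl (suc ℓ) y rewrite reach-refl ℓ y = refl

  reach-step : ∀ ℓ {x z y} → adj G x z ≡ true → reach G ℓ z y ≡ true → reach G (suc ℓ) x y ≡ true
  reach-step ℓ {x} {z} {y} xz zy = trans (cong (reach G ℓ x y ∨_) via-z) (∨-zeroʳ (reach G ℓ x y))
    where
    via-z : any (λ w → adj G x w ∧ reach G ℓ w y) (allFin n) ≡ true
    via-z = any-≡true _ (∈-allFin z) (cong₂ _∧_ xz zy)

  reach-0 : ∀ {x y} → x ≢ y → reach G 0 x y ≡ false
  reach-0 {x} {y} x≢y = ⌊⌋-false (x ≟ y) x≢y

  reach-1 : ∀ {x y} → x ≢ y → adj G x y ≡ false → reach G 1 x y ≡ false
  reach-1 {x} {y} x≢y ¬xy = cong₂ _∨_ (reach-0 x≢y) (any-≡false _ no-step (allFin n))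
    where
    no-step : ∀ z → (adj G x z ∧ ⌊ z ≟ y ⌋) ≡ false
    no-step z with z ≟ y
    ... | yes refl = cong (_∧ true) ¬xy
    ... | no _ = ∧-zeroʳ (adj G x z)

  reached-from : ∀ {x y} (f : ℕ → ℕ) m → (∀ i → reach G (f i) x y ≡ true) →
    List.sum (map (unreached x y) (applyUpTo f m)) ≡ 0
  reached-from f zero _ = refl
  reached-from {x} {y} f (suc m) r rewrite r 0 = reached-from (λ i → f (suc i)) m (λ i → r (suc i))

open Distance

-- For n ≥ 2, `dist G x y` unfolds to the flags for ℓ = 0 and ℓ = 1 plus those for ℓ ≥ 2.
dist-≥1 : ∀ {n} (G : Graph n) {x y} → x ≢ y → 1 ≤ dist G x y
dist-≥1 {suc zero} G {zero} {zero} x≢y = ⊥-elim (x≢y refl)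
dist-≥1 {suc (suc n)} G {x} {y} x≢y =
  ℕP.≤-trans (ℕP.≤-reflexive (sym (if-0-1-cong (reach-0 G x≢y)))) (ℕP.m≤m+n _ _)

dist-≥2 : ∀ {n} (G : Graph n) {x y} → x ≢ y → adj G x y ≡ false → 2 ≤ dist G x y
dist-≥2 {suc zero} G {zero} {zero} x≢y _ = ⊥-elim (x≢y refl)
dist-≥2 {suc (suc n)} G {x} {y} x≢y ¬xy = ℕP.+-mono-≤
  (ℕP.≤-reflexive (sym (if-0-1-cong (reach-0 G x≢y))))
  (ℕP.≤-trans (ℕP.≤-reflexive (sym (if-0-1-cong (reach-1 G x≢y ¬xy)))) (ℕP.m≤m+n _ _))

dist-≡1 : ∀ {n} (G : Graph n) {x y} → x ≢ y → adj G x y ≡ true → dist G x y ≡ 1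
dist-≡1 {suc zero} G {zero} {zero} x≢y _ = ⊥-elim (x≢y refl)
dist-≡1 {suc (suc n)} G {x} {y} x≢y xy = cong₂ _+_ (if-0-1-cong (reach-0 G x≢y))
  (cong₂ _+_ (if-0-1-cong (reached 0))
             (reached-from G (λ i → suc (suc i)) n (λ i → reached (suc i))))
  where
  reached : ∀ ℓ → reach G (suc ℓ) x y ≡ true
  reached ℓ = reach-step G ℓ xy (reach-refl G ℓ y)

dist-≡2 : ∀ {n} (G : Graph n) {x y z} → x ≢ y → adj G x y ≡ false →
  adj G x z ≡ true → adj G z y ≡ true → dist G x y ≡ 2
dist-≡2 {suc zero} G {zero} {zero} x≢y _ _ _ = ⊥-elim (x≢y refl)
dist-≡2 {suc (suc n)} G {x} {y} x≢y ¬xy xz zy = cong₂ _+_ (if-0-1-cong (reach-0 G x≢y))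
  (cong₂ _+_ (if-0-1-cong (reach-1 G x≢y ¬xy))
             (reached-from G (λ i → suc (suc i)) n reached))
  where
  reached : ∀ ℓ → reach G (suc (suc ℓ)) x y ≡ true
  reached ℓ = reach-step G (suc ℓ) xz (reach-step G ℓ zy (reach-refl G ℓ y))

module Halving where
  open import Data.Integer as ℤ using (+_; +≤+)
  import Data.Integer.Properties as ℤP
  open import Data.Integer.Tactic.RingSolver using (solve-∀)
  open import Data.Rational.Unnormalised as ℚᵘ using (mkℚᵘ; *≤*; *≡*)
  import Data.Rational.Unnormalised.Properties as ℚᵘP

  half : ℕ → ℚ
  half a = frac a 2

  -- `frac a (suc d)` is definitionally `fromℚᵘ (mkℚᵘ (+ a) d)`.
  toℚᵘ-frac : ∀ a d → ℚ.toℚᵘ (frac a (suc d)) ℚᵘ.≃ mkℚᵘ (+ a) d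
  toℚᵘ-frac a d = ℚP.toℚᵘ-fromℚᵘ (mkℚᵘ (+ a) d)

  frac-≤ : ∀ a d b e → a * suc e ≤ b * suc d → frac a (suc d) ≤ℚ frac b (suc e)
  frac-≤ a d b e ae≤bd = ℚP.toℚᵘ-cancel-≤
    (ℚᵘP.≤-respˡ-≃ (ℚᵘP.≃-sym (toℚᵘ-frac a d)) (ℚᵘP.≤-respʳ-≃ (ℚᵘP.≃-sym (toℚᵘ-frac b e))
      (*≤* (subst₂ ℤ._≤_ (ℤP.pos-* a (suc e)) (ℤP.pos-* b (suc d)) (+≤+ ae≤bd)))))

  frac-≤⁻ : ∀ a d b e → frac a (suc d) ≤ℚ frac b (suc e) → a * suc e ≤ b * suc d
  frac-≤⁻ a d b e p
    with ℚᵘP.≤-respˡ-≃ (toℚᵘ-frac a d) (ℚᵘP.≤-respʳ-≃ (toℚᵘ-frac b e) (ℚP.toℚᵘ-mono-≤ p))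
  ... | *≤* ae≤bd = ℤP.drop‿+≤+ (subst₂ ℤ._≤_ (sym (ℤP.pos-* a (suc e))) (sym (ℤP.pos-* b (suc d))) ae≤bd)

  half-mono-≤ : ∀ {a b} → a ≤ b → half a ≤ℚ half b
  half-mono-≤ {a} {b} a≤b = frac-≤ a 1 b 1 (ℕP.*-monoˡ-≤ 2 a≤b)

  half-cancel-≤ : ∀ {a b} → half a ≤ℚ half b → a ≤ b
  half-cancel-≤ {a} {b} p = ℕP.*-cancelʳ-≤ a b 2 (frac-≤⁻ a 1 b 1 p)

  half-+ : ∀ a b → half (a + b) ≡ half a ℚ.+ half b
  half-+ a b = ℚP.toℚᵘ-injective (ℚᵘP.≃-trans (toℚᵘ-frac (a + b) 1) (ℚᵘP.≃-trans halves
    (ℚᵘP.≃-sym (ℚᵘP.≃-trans (ℚP.toℚᵘ-homo-+ (half a) (half b))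
                            (ℚᵘP.+-cong (toℚᵘ-frac a 1) (toℚᵘ-frac b 1))))))
    where
    halves : mkℚᵘ (+ (a + b)) 1 ℚᵘ.≃ mkℚᵘ (+ a) 1 ℚᵘ.+ mkℚᵘ (+ b) 1
    halves = *≡* (trans (cong (ℤ._* (+ 4)) (ℤP.pos-+ a b)) (identity (+ a) (+ b)))
      where
      identity : ∀ x y → (x ℤ.+ y) ℤ.* + 4 ≡ (x ℤ.* + 2 ℤ.+ y ℤ.* + 2) ℤ.* + 2
      identity = solve-∀

  frac-≤-double : ∀ a d → 1 ≤ d → frac a d ≤ℚ half (a + a)
  frac-≤-double a (suc d) _ = frac-≤ a d (a + a) 1 (begin
    a * 2        ≡⟨ ℕP.*-comm a 2 ⟩
    a + (a + 0)  ≡⟨ cong (λ z → a + z) (ℕP.+-identityʳ a) ⟩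
    a + a        ≤⟨ ℕP.m≤m*n (a + a) (suc d) ⟩
    (a + a) * suc d ∎)
    where open ℕP.≤-Reasoning

  frac-≤-half : ∀ a d → 2 ≤ d → frac a d ≤ℚ half a
  frac-≤-half a (suc d) (s≤s 1≤d) = frac-≤ a d a 1 (ℕP.*-monoʳ-≤ a (s≤s 1≤d))

  frac-1 : ∀ a → frac a 1 ≡ half (a + a)
  frac-1 a = ℚP.≤-antisym (frac-≤-double a 1 (s≤s z≤n)) (frac-≤ (a + a) 1 a 0 (ℕP.≤-reflexive (begin
    (a + a) * 1   ≡⟨ ℕP.*-identityʳ (a + a) ⟩
    a + a         ≡⟨ cong (λ z → a + z) (sym (ℕP.+-identityʳ a)) ⟩
    a + (a + 0)   ≡⟨ ℕP.*-comm 2 a ⟩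
    a * 2         ∎)))
    where open ≡-Reasoning

  sumℚ-tabulate-≤ : ∀ {n} (f : Fin n → ℚ) (g : Fin n → ℕ) → (∀ i → f i ≤ℚ half (g i)) →
    sumℚ (tabulate f) ≤ℚ half (sum g)
  sumℚ-tabulate-≤ {zero} f g _ = ℚP.≤-refl
  sumℚ-tabulate-≤ {suc n} f g f≤g = subst (sumℚ (tabulate f) ≤ℚ_) (sym (half-+ (g zero) _))
    (ℚP.+-mono-≤ (f≤g zero) (sumℚ-tabulate-≤ (λ i → f (suc i)) (λ i → g (suc i)) (λ i → f≤g (suc i))))

  sumℚ-tabulate-≡ : ∀ {n} (f : Fin n → ℚ) (g : Fin n → ℕ) → (∀ i → f i ≡ half (g i)) →
    sumℚ (tabulate f) ≡ half (sum g)
  sumℚ-tabulate-≡ {zero} f g _ = refl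
  sumℚ-tabulate-≡ {suc n} f g f≡g = trans
    (cong₂ ℚ._+_ (f≡g zero) (sumℚ-tabulate-≡ (λ i → f (suc i)) (λ i → g (suc i)) (λ i → f≡g (suc i))))
    (sym (half-+ (g zero) _))

open Halving using (half; half-mono-≤; half-cancel-≤)

-- Reciprocal degree distance and degrees

-- In Σ_{x<y} pairWeight x y (`pairSum-≡`) the degree d of x occurs once for each of the n − 1 other
-- vertices and once more for each of its d neighbours.
vertexWeight : ℕ → ℕ → ℕ
vertexWeight n d = (n ∸ 1) * d + d * d

degreeWeight : ∀ {n} → Graph n → ℕ
degreeWeight {n} G = sum (λ x → vertexWeight n (deg G x))

deg-sum : ∀ {n} (G : Graph n) x → deg G x ≡ sum (λ y → ind (adj G x y))
deg-sum G x = sum-allFin (λ y → ind (adj G x y))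

module PairSum {n} (G : Graph n) where
  open Halving

  pairDeg : Fin n → Fin n → ℕ
  pairDeg x y = deg G x + deg G y

  -- Twice (d(x) + d(y))/d(x,y) when d(x,y) ∈ {1, 2}, and an upper bound for it otherwise.
  pairWeight : Fin n → Fin n → ℕ
  pairWeight x y = if adj G x y then pairDeg x y + pairDeg x y else pairDeg x y

  ordered : Fin n → Fin n → Bool
  ordered x y = ⌊ toℕ x <? toℕ y ⌋

  orderedWeight : Fin n → Fin n → ℕ
  orderedWeight x y = if ordered x y then pairWeight x y else 0

  pairSum : ℕ
  pairSum = sum λ x → sum λ y → orderedWeight x y

  rddTerm : Fin n → Fin n → ℚ
  rddTerm x y = if ordered x y then frac (pairDeg x y) (dist G x y) else 0ℚ

  RDD-tabulate : RDD G ≡ sumℚ (tabulate λ x → sumℚ (tabulate (rddTerm x)))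
  RDD-tabulate = trans (cong sumℚ (map-tabulate (λ x → x) (λ x → sumℚ (map (rddTerm x) (allFin n)))))
    (cong sumℚ (tabulate-cong (λ x → cong sumℚ (map-tabulate (λ y → y) (rddTerm x)))))

  <⇒≢ : ∀ {x y : Fin n} → toℕ x < toℕ y → x ≢ y
  <⇒≢ x<y refl = ℕP.<-irrefl refl x<y

  rddTerm-≤ : ∀ x y → rddTerm x y ≤ℚ half (orderedWeight x y)
  rddTerm-≤ x y with toℕ x <? toℕ y
  ... | no _ = ℚP.≤-refl
  ... | yes x<y with adj G x y in xy
  ...   | true = frac-≤-double (pairDeg x y) (dist G x y) (dist-≥1 G (<⇒≢ x<y))
  ...   | false = frac-≤-half (pairDeg x y) (dist G x y) (dist-≥2 G (<⇒≢ x<y) xy)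

  RDD-≤ : RDD G ≤ℚ half pairSum
  RDD-≤ = subst (_≤ℚ half pairSum) (sym RDD-tabulate) (sumℚ-tabulate-≤ _ _ (λ x →
    sumℚ-tabulate-≤ (rddTerm x) (orderedWeight x) (rddTerm-≤ x)))

  Diameter≤2 : Set
  Diameter≤2 = ∀ x y → x ≢ y → adj G x y ≡ false → ∃ λ z → adj G x z ≡ true × adj G z y ≡ true

  rddTerm-≡ : Diameter≤2 → ∀ x y → rddTerm x y ≡ half (orderedWeight x y)
  rddTerm-≡ diam x y with toℕ x <? toℕ y
  ... | no _ = refl
  ... | yes x<y with adj G x y in xy
  ...   | true = trans (cong (frac (pairDeg x y)) (dist-≡1 G (<⇒≢ x<y) xy)) (frac-1 (pairDeg x y))
  ...   | false with diam x y (<⇒≢ x<y) xy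
  ...     | z , xz , zy = cong (frac (pairDeg x y)) (dist-≡2 G (<⇒≢ x<y) xy xz zy)

  RDD-≡ : Diameter≤2 → RDD G ≡ half pairSum
  RDD-≡ diam = trans RDD-tabulate (sumℚ-tabulate-≡ _ _ (λ x →
    sumℚ-tabulate-≡ (rddTerm x) (orderedWeight x) (rddTerm-≡ diam x)))

  module _ (simple : Simple G) where

    loopless : ∀ {x y} → adj G x y ≡ true → x ≢ y
    loopless {x} xy refl with trans (sym xy) (proj₂ simple x)
    ... | ()

    pairWeight-sym : ∀ x y → pairWeight x y ≡ pairWeight y x
    pairWeight-sym x y rewrite proj₁ simple x y | ℕP.+-comm (deg G x) (deg G y) = refl

    orderedWeight-both : ∀ x y → orderedWeight x y + orderedWeight y x ≡ ind (not ⌊ x ≟ y ⌋) * pairWeight x y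
    orderedWeight-both x y with toℕ x <? toℕ y | toℕ y <? toℕ x
    ... | yes x<y | yes y<x = ⊥-elim (ℕP.<-asym x<y y<x)
    ... | yes x<y | no _ rewrite ⌊⌋-false (x ≟ y) (<⇒≢ x<y) =
      trans (ℕP.+-identityʳ _) (sym (ℕP.*-identityˡ _))
    ... | no _ | yes y<x rewrite ⌊⌋-false (x ≟ y) (λ x≡y → <⇒≢ y<x (sym x≡y)) =
      trans (pairWeight-sym y x) (sym (ℕP.*-identityˡ _))
    ... | no x≮y | no y≮x rewrite FinP.toℕ-injective (ℕP.≤-antisym (ℕP.≮⇒≥ y≮x) (ℕP.≮⇒≥ x≮y))
                                | ⌊⌋-true (y ≟ y) refl = refl

    pairWeight-split : ∀ x y → ind (not ⌊ x ≟ y ⌋) * pairWeight x y ≡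
                               (ind (not ⌊ x ≟ y ⌋) + ind (adj G x y)) * pairDeg x y
    pairWeight-split x y with adj G x y in xy
    ... | true rewrite ⌊⌋-false (x ≟ y) (loopless xy) =
      trans (ℕP.*-identityˡ _) (cong (pairDeg x y +_) (sym (ℕP.+-identityʳ (pairDeg x y))))
    ... | false = cong (_* pairDeg x y) (sym (ℕP.+-identityʳ (ind (not ⌊ x ≟ y ⌋))))

    pairSum-≡ : pairSum ≡ degreeWeight G
    pairSum-≡ = double-injective (begin
      pairSum + pairSum
        ≡⟨ cong (pairSum +_) (∑-comm (λ x y → orderedWeight y x)) ⟨
      pairSum + sum (λ x → sum (λ y → orderedWeight y x))
        ≡⟨ sym (∑-distrib-+ (λ x → sum (orderedWeight x)) (λ x → sum (λ y → orderedWeight y x))) ⟩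
      sum (λ x → sum (orderedWeight x) + sum (λ y → orderedWeight y x))
        ≡⟨ sum-cong-≗ (λ x → trans (sym (∑-distrib-+ (orderedWeight x) (λ y → orderedWeight y x)))
              (sum-cong-≗ (λ y → trans (orderedWeight-both x y) (pairWeight-split x y)))) ⟩
      sum (λ x → sum (λ y → c x y * (deg G x + deg G y)))
        ≡⟨ sum-symmetric c (deg G) c-sym ⟩
      S + S
        ≡⟨ cong₂ _+_ S≡degreeWeight S≡degreeWeight ⟩
      degreeWeight G + degreeWeight G ∎)
      where
      open ≡-Reasoning
      c : Fin n → Fin n → ℕ
      c x y = ind (not ⌊ x ≟ y ⌋) + ind (adj G x y)
      c-sym : ∀ x y → c x y ≡ c y x
      c-sym x y = cong₂ (λ b b′ → ind (not b) + ind b′) (⌊≟⌋-sym x y) (proj₁ simple x y)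
      S : ℕ
      S = sum (λ x → sum (c x) * deg G x)
      S≡degreeWeight : S ≡ degreeWeight G
      S≡degreeWeight = sum-cong-≗ λ x → begin
        sum (c x) * deg G x
          ≡⟨ cong (_* deg G x) (∑-distrib-+ (λ y → ind (not ⌊ x ≟ y ⌋)) (λ y → ind (adj G x y))) ⟩
        (sum (λ y → ind (not ⌊ x ≟ y ⌋)) + sum (λ y → ind (adj G x y))) * deg G x
          ≡⟨ cong₂ (λ a b → (a + b) * deg G x) (sum-offDiagonal x) (sym (deg-sum G x)) ⟩
        (n ∸ 1 + deg G x) * deg G x
          ≡⟨ ℕP.*-distribʳ-+ (deg G x) (n ∸ 1) (deg G x) ⟩
        vertexWeight n (deg G x) ∎


module Counting {A : Set} (_≟ᴬ_ : DecidableEquality A) where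

  count : ∀ {n} → (Fin n → A) → A → ℕ
  count L v = sum λ x → ind ⌊ v ≟ᴬ L x ⌋

  count-permute : ∀ {n N} (π : Permutation n N) (M : Fin N → A) v → count (λ x → M (π ⟨$⟩ʳ x)) v ≡ count M v
  count-permute π M v = sym (sum-permute (λ y → ind ⌊ v ≟ᴬ M y ⌋) π)

  count-splitAt : ∀ a {b} (L₁ : Fin a → A) (L₂ : Fin b → A) v →
    count (λ u → [ L₁ , L₂ ]′ (splitAt a u)) v ≡ count L₁ v + count L₂ v
  count-splitAt a L₁ L₂ v = sum-splitAt a (λ z → ind ⌊ v ≟ᴬ [ L₁ , L₂ ]′ z ⌋)

  permutation-from-counts : ∀ {n N} (L : Fin n → A) (M : Fin N → A) → (∀ v → count L v ≡ count M v) →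
    Σ (Permutation n N) λ π → ∀ x → M (π ⟨$⟩ʳ x) ≡ L x
  permutation-from-counts {zero} {zero} L M _ = Perm.id , λ ()
  permutation-from-counts {zero} {suc N} L M counts
    with trans (counts (M zero)) (cong (λ b → ind b + count (λ x → M (suc x)) (M zero)) (⌊⌋-true (M zero ≟ᴬ M zero) refl))
  ... | ()
  permutation-from-counts {suc n} {N} L M counts
    with sum-pos⇒∃ (λ y → ind ⌊ L zero ≟ᴬ M y ⌋)
           (subst (0 <_) (counts (L zero)) (subst (λ b → 0 < ind b + count (λ x → L (suc x)) (L zero))
                                                  (sym (⌊⌋-true (L zero ≟ᴬ L zero) refl)) (s≤s z≤n)))
  permutation-from-counts {suc n} {suc N} L M counts | j , hit = Perm.insert zero j π , matches
    where
    Mj≡L₀ : M j ≡ L zero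
    Mj≡L₀ = sym (⌊⌋-sound (L zero ≟ᴬ M j) (ind-pos hit))
    rest : Σ (Permutation n N) λ π → ∀ x → M (punchIn j (π ⟨$⟩ʳ x)) ≡ L (suc x)
    rest = permutation-from-counts (λ x → L (suc x)) (λ y → M (punchIn j y)) λ v →
      ℕP.+-cancelˡ-≡ (ind ⌊ v ≟ᴬ L zero ⌋) _ _ (trans (counts v)
        (trans (sum-remove {i = j} (λ y → ind ⌊ v ≟ᴬ M y ⌋)) (cong (λ w → ind ⌊ v ≟ᴬ w ⌋ + _) Mj≡L₀)))
    π = proj₁ rest
    matches : ∀ x → M (Perm.insert zero j π ⟨$⟩ʳ x) ≡ L x
    matches zero = Mj≡L₀
    matches (suc x) = trans (cong M (Perm.insert-punchIn zero j π x)) (proj₂ rest x)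

count-map : ∀ {A B : Set} (_≟ᴬ_ : DecidableEquality A) (_≟ᴮ_ : DecidableEquality B) {f : A → B} →
  (∀ {a a′} → f a ≡ f a′ → a ≡ a′) → ∀ {n} (L : Fin n → A) v →
  Counting.count _≟ᴮ_ (f ∘ L) (f v) ≡ Counting.count _≟ᴬ_ L v
count-map _≟ᴬ_ _≟ᴮ_ f-inj L v = sum-cong-≗ (λ x → cong ind (⌊≟⌋-injective _≟ᴬ_ _≟ᴮ_ f-inj v (L x)))

count-map-∉ : ∀ {A B : Set} (_≟ᴮ_ : DecidableEquality B) {f : A → B} {v} → (∀ a → v ≢ f a) →
  ∀ {n} (L : Fin n → A) → Counting.count _≟ᴮ_ (f ∘ L) v ≡ 0
count-map-∉ _≟ᴮ_ {f} {v} v∉f {n} L = trans (sum-cong-≗ (λ x → cong ind (⌊⌋-false (v ≟ᴮ f (L x)) (v∉f (L x)))))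
  (sum-zero n)

-- `nothing` marks a deleted (apex) vertex and `just i` a vertex of part i.
Labelling : ℕ → ℕ → Set
Labelling n k = Fin n → Maybe (Fin k)

infix 4 _≟ᴹ_
_≟ᴹ_ : ∀ {k} → DecidableEquality (Maybe (Fin k))
_≟ᴹ_ = MaybeP.≡-dec _≟_

labelCount : ∀ {n k} → Labelling n k → Maybe (Fin k) → ℕ
labelCount = Counting.count _≟ᴹ_

apexCount : ∀ {n k} → Labelling n k → ℕ
apexCount L = labelCount L nothing

classSize : ∀ {n k} → Labelling n k → Fin k → ℕ
classSize L i = labelCount L (just i)

sameClass : ∀ {k} → Maybe (Fin k) → Maybe (Fin k) → Bool
sameClass (just i) (just j) = ⌊ i ≟ j ⌋
sameClass _ _ = false

allowed : ∀ {n k} → Labelling n k → Fin n → Fin n → Bool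
allowed L x y = not ⌊ x ≟ y ⌋ ∧ not (sameClass (L x) (L y))

Proper : ∀ {n k} → Graph n → Labelling n k → Set
Proper G L = ∀ x y → adj G x y ≡ true → allowed L x y ≡ true

-- G is the join of the complete graph on the apex vertices with the complete multipartite graph
-- on the parts.
Saturated : ∀ {n k} → Graph n → Labelling n k → Set
Saturated G L = ∀ x y → adj G x y ≡ allowed L x y

allowedDeg : ∀ {n k} → Labelling n k → Fin n → ℕ
allowedDeg L x = sum (λ y → ind (allowed L x y))

classWeight : ℕ → ℕ → ℕ
classWeight n a = a * vertexWeight n (n ∸ a)

capacity : ∀ {n k} → Labelling n k → ℕ
capacity {n} L = sum (λ x → vertexWeight n (allowedDeg L x))

sameClass-just : ∀ {k} (i : Fin k) l → sameClass (just i) l ≡ ⌊ just i ≟ᴹ l ⌋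
sameClass-just i nothing = refl
sameClass-just i (just j) = sym (⌊⌋-map′ (cong just) MaybeP.just-injective (i ≟ j))

sameClass-nothingʳ : ∀ {k} (l : Maybe (Fin k)) → sameClass l nothing ≡ false
sameClass-nothingʳ nothing = refl
sameClass-nothingʳ (just _) = refl

sameClass-sym : ∀ {k} (l l′ : Maybe (Fin k)) → sameClass l l′ ≡ sameClass l′ l
sameClass-sym (just i) (just j) = ⌊≟⌋-sym i j
sameClass-sym (just _) nothing = refl
sameClass-sym nothing (just _) = refl
sameClass-sym nothing nothing = refl

sameClass-map : ∀ {k k′} {f : Fin k → Fin k′} → (∀ {i j} → f i ≡ f j → i ≡ j) →
  ∀ l l′ → sameClass (Maybe.map f l) (Maybe.map f l′) ≡ sameClass l l′
sameClass-map f-inj (just i) (just j) = ⌊≟⌋-injective _≟_ _≟_ f-inj i j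
sameClass-map f-inj (just _) nothing = refl
sameClass-map f-inj nothing _ = refl

module _ {n k} (L : Labelling n k) where

  fibres : (F : Maybe (Fin k) → ℕ) →
    sum (λ x → F (L x)) ≡ apexCount L * F nothing + sum (λ i → classSize L i * F (just i))
  fibres F = begin
    sum (λ x → F (L x))
      ≡⟨ sum-cong-≗ (λ x → split (L x)) ⟩
    sum (λ x → ind ⌊ nothing ≟ᴹ L x ⌋ * F nothing + sum (λ i → ind ⌊ just i ≟ᴹ L x ⌋ * F (just i)))
      ≡⟨ ∑-distrib-+ (λ x → ind ⌊ nothing ≟ᴹ L x ⌋ * F nothing)
                     (λ x → sum (λ i → ind ⌊ just i ≟ᴹ L x ⌋ * F (just i))) ⟩
    sum (λ x → ind ⌊ nothing ≟ᴹ L x ⌋ * F nothing) + sum (λ x → sum (λ i → ind ⌊ just i ≟ᴹ L x ⌋ * F (just i)))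
      ≡⟨ cong₂ _+_ (sum-*ʳ (F nothing) (λ x → ind ⌊ nothing ≟ᴹ L x ⌋))
                   (∑-comm (λ x i → ind ⌊ just i ≟ᴹ L x ⌋ * F (just i))) ⟩
    apexCount L * F nothing + sum (λ i → sum (λ x → ind ⌊ just i ≟ᴹ L x ⌋ * F (just i)))
      ≡⟨ cong (apexCount L * F nothing +_) (sum-cong-≗ (λ i → sum-*ʳ (F (just i)) (λ x → ind ⌊ just i ≟ᴹ L x ⌋))) ⟩
    apexCount L * F nothing + sum (λ i → classSize L i * F (just i)) ∎
    where
    open ≡-Reasoning
    split : ∀ l → F l ≡ ind ⌊ nothing ≟ᴹ l ⌋ * F nothing + sum (λ i → ind ⌊ just i ≟ᴹ l ⌋ * F (just i))
    split nothing = sym (trans (cong₂ _+_ (ℕP.*-identityˡ (F nothing)) (sum-zero k)) (ℕP.+-identityʳ (F nothing)))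
    split (just j) = sym (trans
      (sum-cong-≗ (λ i → cong (λ b → ind b * F (just i)) (⌊⌋-map′ (cong just) MaybeP.just-injective (i ≟ j))))
      (sum-δ j (λ i → F (just i))))

  vertexCount : apexCount L + sum (classSize L) ≡ n
  vertexCount = begin
    apexCount L + sum (classSize L)
      ≡⟨ cong₂ _+_ (sym (ℕP.*-identityʳ _)) (sum-cong-≗ (λ i → sym (ℕP.*-identityʳ (classSize L i)))) ⟩
    apexCount L * 1 + sum (λ i → classSize L i * 1)
      ≡⟨ fibres (λ _ → 1) ⟨
    sum {n} (λ _ → 1)
      ≡⟨ trans (sum-const n 1) (ℕP.*-identityʳ n) ⟩
    n ∎
    where open ≡-Reasoning

  allowedDeg-apex : ∀ {x} → L x ≡ nothing → allowedDeg L x ≡ n ∸ 1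
  allowedDeg-apex {x} Lx≡ = trans (sum-cong-≗ λ y → cong ind
    (trans (cong (λ l → not ⌊ x ≟ y ⌋ ∧ not (sameClass l (L y))) Lx≡) (∧-identityʳ _))) (sum-offDiagonal x)

  allowedDeg-class : ∀ {x i} → L x ≡ just i → allowedDeg L x + classSize L i ≡ n
  allowedDeg-class {x} {i} Lx≡ = begin
    allowedDeg L x + classSize L i
      ≡⟨ ∑-distrib-+ (λ y → ind (allowed L x y)) (λ y → ind ⌊ just i ≟ᴹ L y ⌋) ⟨
    sum (λ y → ind (allowed L x y) + ind ⌊ just i ≟ᴹ L y ⌋)
      ≡⟨ sum-cong-≗ exactly-one ⟩
    sum {n} (λ _ → 1)
      ≡⟨ trans (sum-const n 1) (ℕP.*-identityʳ n) ⟩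
    n ∎
    where
    open ≡-Reasoning
    exactly-one : ∀ y → ind (allowed L x y) + ind ⌊ just i ≟ᴹ L y ⌋ ≡ 1
    exactly-one y with x ≟ y
    ... | yes refl rewrite Lx≡ | ⌊⌋-true (just i ≟ᴹ just i) refl = refl
    ... | no _ rewrite Lx≡ | sameClass-just i (L y) = ind-not ⌊ just i ≟ᴹ L y ⌋

  capacity-≡ : capacity L ≡ apexCount L * vertexWeight n (n ∸ 1) + sum (λ i → classWeight n (classSize L i))
  capacity-≡ = trans (sum-cong-≗ (λ x → by-label x (L x) refl)) (fibres F)
    where
    F : Maybe (Fin k) → ℕ
    F nothing = vertexWeight n (n ∸ 1)
    F (just i) = vertexWeight n (n ∸ classSize L i)
    by-label : ∀ x l → L x ≡ l → vertexWeight n (allowedDeg L x) ≡ F l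
    by-label x nothing Lx≡ = cong (vertexWeight n) (allowedDeg-apex Lx≡)
    by-label x (just i) Lx≡ = cong (vertexWeight n) (trans
      (sym (ℕP.m+n∸n≡m (allowedDeg L x) (classSize L i))) (cong (_∸ classSize L i) (allowedDeg-class Lx≡)))

vertexWeight-mono-≤ : ∀ n {u v} → u ≤ v → vertexWeight n u ≤ vertexWeight n v
vertexWeight-mono-≤ n u≤v = ℕP.+-mono-≤ (ℕP.*-monoʳ-≤ (n ∸ 1) u≤v) (ℕP.*-mono-≤ u≤v u≤v)

vertexWeight-mono-< : ∀ n {u v} → u < v → vertexWeight n u < vertexWeight n v
vertexWeight-mono-< n u<v = ℕP.+-mono-≤-< (ℕP.*-monoʳ-≤ (n ∸ 1) (ℕP.<⇒≤ u<v)) (ℕP.*-mono-< u<v u<v)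

module Degrees {n k} (G : Graph n) (L : Labelling n k) where

  adj-≤-allowed : Proper G L → ∀ x y → ind (adj G x y) ≤ ind (allowed L x y)
  adj-≤-allowed proper x y with adj G x y in xy
  ... | false = z≤n
  ... | true rewrite proper x y xy = ℕP.≤-refl

  deg-≤-allowedDeg : Proper G L → ∀ x → deg G x ≤ allowedDeg L x
  deg-≤-allowedDeg proper x = subst (_≤ allowedDeg L x) (sym (deg-sum G x)) (sum-mono-≤ (adj-≤-allowed proper x))

  degreeWeight-≤-capacity : Proper G L → degreeWeight G ≤ capacity L
  degreeWeight-≤-capacity proper = sum-mono-≤ (λ x → vertexWeight-mono-≤ n (deg-≤-allowedDeg proper x))

  degreeWeight-≡-capacity : Saturated G L → degreeWeight G ≡ capacity L
  degreeWeight-≡-capacity sat = sum-cong-≗ λ x →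
    cong (vertexWeight n) (trans (deg-sum G x) (sum-cong-≗ (λ y → cong ind (sat x y))))

  degreeWeight-≡⇒saturated : Proper G L → degreeWeight G ≡ capacity L → Saturated G L
  degreeWeight-≡⇒saturated proper equal x y = ind-injective (sum-mono-≤-≡⇒≡ (adj-≤-allowed proper x) deg≡allowedDeg y)
    where
    deg≡allowedDeg : sum (λ y → ind (adj G x y)) ≡ allowedDeg L x
    deg≡allowedDeg with ℕP.m≤n⇒m<n∨m≡n (deg-≤-allowedDeg proper x)
    ... | inj₂ deg≡ = trans (sym (deg-sum G x)) deg≡
    ... | inj₁ deg< = ⊥-elim (ℕP.<⇒≢ (vertexWeight-mono-< n deg<)
            (sum-mono-≤-≡⇒≡ (λ z → vertexWeight-mono-≤ n (deg-≤-allowedDeg proper z)) equal x))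

-- The arithmetic of the bound

-- 2·bound − capacity = (m − m′)·apexPenalty n s + Σ_i classPenalty n s a_i; see `bound-decomposition`.
apexPenalty : ℕ → ℕ → ℕ
apexPenalty n s = s * (6 * n ∸ (3 * s + 5))

-- (a − s)(a − s − 1) computed in ℕ: at most one of the two products is non-zero.
imbalance : ℕ → ℕ → ℕ
imbalance a s = (a ∸ s) * (a ∸ suc s) + (s ∸ a) * (suc s ∸ a)

classPenalty : ℕ → ℕ → ℕ → ℕ
classPenalty n s a = imbalance a s * (3 * n ∸ (2 + 2 * s + a))

3s+5<6n : ∀ {n s} → s < n → 3 * s + 5 < 6 * n
3s+5<6n {n} {s} s<n = begin-strict
  3 * s + 5      ≤⟨ ℕP.+-monoˡ-≤ 5 (ℕP.*-monoˡ-≤ s (s≤s (s≤s (s≤s (z≤n {3}))))) ⟩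
  6 * s + 5      <⟨ ℕP.+-monoʳ-< (6 * s) (ℕP.n<1+n 5) ⟩
  6 * s + 6      ≡⟨ trans (ℕP.+-comm (6 * s) 6) (sym (ℕP.*-suc 6 s)) ⟩
  6 * suc s      ≤⟨ ℕP.*-monoʳ-≤ 6 s<n ⟩
  6 * n          ∎
  where open ℕP.≤-Reasoning

2+2s+a≤3n : ∀ {n s a} → s < n → a ≤ n → 2 + 2 * s + a ≤ 3 * n
2+2s+a≤3n {n} {s} {a} s<n a≤n = begin
  2 + 2 * s + a  ≡⟨ cong (_+ a) (ℕP.*-suc 2 s) ⟨
  2 * suc s + a  ≤⟨ ℕP.+-mono-≤ (ℕP.*-monoʳ-≤ 2 s<n) a≤n ⟩
  2 * n + n      ≡⟨ ℕP.+-comm (2 * n) n ⟩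
  3 * n          ∎
  where open ℕP.≤-Reasoning

s<m+[s*k+t] : ∀ {m s k t} → 1 ≤ m → 1 ≤ k → s < m + (s * k + t)
s<m+[s*k+t] {m} {s} {suc k} {t} m≥1 _ = ℕP.+-mono-≤ m≥1 (ℕP.≤-trans (ℕP.m≤m*n s (suc k)) (ℕP.m≤m+n (s * suc k) t))

apexPenalty-pos : ∀ {n s} → 1 ≤ s → s < n → 1 ≤ apexPenalty n s
apexPenalty-pos s≥1 s<n = ℕP.*-mono-≤ s≥1 (ℕP.m<n⇒0<n∸m (3s+5<6n s<n))

imbalance-balanced : ∀ s b → imbalance (s + ind b) s ≡ 0
imbalance-balanced s false rewrite ℕP.+-identityʳ s | ℕP.n∸n≡0 s = refl
imbalance-balanced s true rewrite ℕP.+-comm s 1 | ℕP.n∸n≡0 s | ℕP.*-zeroʳ (suc s ∸ s) = ℕP.*-zeroʳ (s ∸ suc s)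

classPenalty-balanced : ∀ n s b → classPenalty n s (s + ind b) ≡ 0
classPenalty-balanced n s b = cong (_* (3 * n ∸ (2 + 2 * s + (s + ind b)))) (imbalance-balanced s b)

imbalance≡0⇒ : ∀ {a s} → imbalance a s ≡ 0 → a ≡ s ⊎ a ≡ suc s
imbalance≡0⇒ {a} {s} zero-sum with ℕP.m≤n⇒m<n∨m≡n (s≤a (ℕP.m+n≡0⇒n≡0 _ zero-sum))
  where
  s≤a : (s ∸ a) * (suc s ∸ a) ≡ 0 → s ≤ a
  s≤a p with ℕP.m*n≡0⇒m≡0∨n≡0 (s ∸ a) p
  ... | inj₁ s∸a≡0 = ℕP.m∸n≡0⇒m≤n s∸a≡0
  ... | inj₂ 1+s∸a≡0 = ℕP.≤-trans (ℕP.n≤1+n s) (ℕP.m∸n≡0⇒m≤n 1+s∸a≡0)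
... | inj₂ s≡a = inj₁ (sym s≡a)
... | inj₁ s<a with ℕP.m*n≡0⇒m≡0∨n≡0 (a ∸ s) (ℕP.m+n≡0⇒m≡0 _ zero-sum)
...   | inj₁ a∸s≡0 = ⊥-elim (ℕP.<⇒≱ s<a (ℕP.m∸n≡0⇒m≤n a∸s≡0))
...   | inj₂ a∸1+s≡0 = inj₂ (ℕP.≤-antisym (ℕP.m∸n≡0⇒m≤n a∸1+s≡0) s<a)

classPenalty≡0⇒ : ∀ {n s a} → s < n → a < n → classPenalty n s a ≡ 0 → a ≡ s ⊎ a ≡ suc s
classPenalty≡0⇒ {n} {s} {a} s<n a<n zero-product with ℕP.m*n≡0⇒m≡0∨n≡0 (imbalance a s) zero-product
... | inj₁ balanced = imbalance≡0⇒ balanced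
... | inj₂ w≡0 = ⊥-elim (ℕP.<⇒≢ (ℕP.m<n⇒0<n∸m (subst (_≤ 3 * n) (ℕP.+-suc (2 + 2 * s) a) (2+2s+a≤3n s<n a<n)))
                                (sym w≡0))

module Arithmetic where
  open import Data.Integer as ℤ using (ℤ; +_) renaming (_+_ to _+ᶻ_; _*_ to _*ᶻ_; _-_ to _-ᶻ_)
  import Data.Integer.Properties as ℤP
  open import Data.Integer.Tactic.RingSolver using (solve-∀)

  -- `bound n m s t` is definitionally `numeratorᶻ (+ n) (+ m) (+ s) (+ t) / 2`.
  numeratorᶻ : ℤ → ℤ → ℤ → ℤ → ℤ
  numeratorᶻ N M S T = (+ 2) ℤ.* N ℤ.* N ℤ.* N ℤ.- N ℤ.* N ℤ.- (+ 3) ℤ.* M ℤ.* N ℤ.+ (+ 2) ℤ.* M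
        ℤ.- (N ℤ.- M) ℤ.* ((+ 3) ℤ.* N ℤ.- S ℤ.- (+ 1)) ℤ.* S
        ℤ.- T ℤ.* (S ℤ.+ (+ 1)) ℤ.* ((+ 3) ℤ.* N ℤ.- (+ 2) ℤ.* S ℤ.- (+ 2))

  vertexWeightᶻ : ℤ → ℤ → ℤ
  vertexWeightᶻ N D = (N -ᶻ + 1) *ᶻ D +ᶻ D *ᶻ D

  classWeightᶻ : ℤ → ℤ → ℤ
  classWeightᶻ N A = A *ᶻ vertexWeightᶻ N (N -ᶻ A)

  slopeᶻ : ℤ → ℤ → ℤ
  slopeᶻ N S = classWeightᶻ N (S +ᶻ + 1) -ᶻ classWeightᶻ N S

  classPenaltyᶻ : ℤ → ℤ → ℤ → ℤ
  classPenaltyᶻ N S A = (A -ᶻ S) *ᶻ (A -ᶻ S -ᶻ + 1) *ᶻ (+ 3 *ᶻ N -ᶻ (+ 2 +ᶻ + 2 *ᶻ S +ᶻ A))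

  apexPenaltyᶻ : ℤ → ℤ → ℤ
  apexPenaltyᶻ N S = S *ᶻ (+ 6 *ᶻ N -ᶻ (+ 3 *ᶻ S +ᶻ + 5))

  -- classWeightᶻ N is a monic cubic in A and classPenaltyᶻ N S is a cubic with leading coefficient
  -- −1 vanishing at S and S + 1, so their sum is the chord of classWeightᶻ N through S and S + 1.
  -- The ring solver does not unfold definitions, so each identity is restated with them inlined.
  chord : ∀ N S A → classWeightᶻ N A +ᶻ classPenaltyᶻ N S A ≡ classWeightᶻ N S +ᶻ (A -ᶻ S) *ᶻ slopeᶻ N S
  chord = identity
    where
    identity : ∀ N S A →
      let h = λ D → (N -ᶻ + 1) *ᶻ D +ᶻ D *ᶻ D
          φ = λ A → A *ᶻ h (N -ᶻ A)
      in φ A +ᶻ (A -ᶻ S) *ᶻ (A -ᶻ S -ᶻ + 1) *ᶻ (+ 3 *ᶻ N -ᶻ (+ 2 +ᶻ + 2 *ᶻ S +ᶻ A))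
         ≡ φ S +ᶻ (A -ᶻ S) *ᶻ (φ (S +ᶻ + 1) -ᶻ φ S)
    identity = solve-∀

  apex-slope : ∀ N S → vertexWeightᶻ N (N -ᶻ + 1) -ᶻ slopeᶻ N S ≡ apexPenaltyᶻ N S
  apex-slope = identity
    where
    identity : ∀ N S →
      let h = λ D → (N -ᶻ + 1) *ᶻ D +ᶻ D *ᶻ D
          φ = λ A → A *ᶻ h (N -ᶻ A)
      in h (N -ᶻ + 1) -ᶻ (φ (S +ᶻ + 1) -ᶻ φ S) ≡ S *ᶻ (+ 6 *ᶻ N -ᶻ (+ 3 *ᶻ S +ᶻ + 5))
    identity = solve-∀

  numerator-closed-form : ∀ M S K T → let N = M +ᶻ (S *ᶻ K +ᶻ T) in
    numeratorᶻ N M S T ≡ M *ᶻ vertexWeightᶻ N (N -ᶻ + 1) +ᶻ K *ᶻ classWeightᶻ N S +ᶻ T *ᶻ slopeᶻ N S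
  numerator-closed-form = identity
    where
    identity : ∀ M S K T →
      let N = M +ᶻ (S *ᶻ K +ᶻ T)
          h = λ D → (N -ᶻ + 1) *ᶻ D +ᶻ D *ᶻ D
          φ = λ A → A *ᶻ h (N -ᶻ A)
      in (+ 2) ℤ.* N ℤ.* N ℤ.* N ℤ.- N ℤ.* N ℤ.- (+ 3) ℤ.* M ℤ.* N ℤ.+ (+ 2) ℤ.* M
           ℤ.- (N ℤ.- M) ℤ.* ((+ 3) ℤ.* N ℤ.- S ℤ.- (+ 1)) ℤ.* S
           ℤ.- T ℤ.* (S ℤ.+ (+ 1)) ℤ.* ((+ 3) ℤ.* N ℤ.- (+ 2) ℤ.* S ℤ.- (+ 2))
         ≡ M *ᶻ h (N -ᶻ + 1) +ᶻ K *ᶻ φ S +ᶻ T *ᶻ (φ (S +ᶻ + 1) -ᶻ φ S)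
    identity = solve-∀

  +-∸ : ∀ {a b} → b ≤ a → + (a ∸ b) ≡ + a -ᶻ + b
  +-∸ {a} {b} b≤a = trans (sym (ℤP.≤-⊖ b≤a)) (sym (ℤP.m-n≡m⊖n a b))

  +-vertexWeight : ∀ {n} d → 1 ≤ n → + vertexWeight n d ≡ vertexWeightᶻ (+ n) (+ d)
  +-vertexWeight {n} d n≥1 =
    cong₂ _+ᶻ_ (trans (ℤP.pos-* (n ∸ 1) d) (cong (_*ᶻ + d) (+-∸ n≥1))) (ℤP.pos-* d d)

  +-classWeight : ∀ {n a} → 1 ≤ n → a ≤ n → + classWeight n a ≡ classWeightᶻ (+ n) (+ a)
  +-classWeight {n} {a} n≥1 a≤n = trans (ℤP.pos-* a (vertexWeight n (n ∸ a)))
    (cong (+ a *ᶻ_) (trans (+-vertexWeight (n ∸ a) n≥1) (cong (vertexWeightᶻ (+ n)) (+-∸ a≤n))))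

  +-apexPenalty : ∀ {n s} → s < n → + apexPenalty n s ≡ apexPenaltyᶻ (+ n) (+ s)
  +-apexPenalty {n} {s} s<n = trans (ℤP.pos-* s _) (cong (+ s *ᶻ_)
    (trans (+-∸ (ℕP.<⇒≤ (3s+5<6n s<n))) (cong₂ _-ᶻ_ (ℤP.pos-* 6 n) (cong (_+ᶻ + 5) (ℤP.pos-* 3 s)))))

  +-imbalance : ∀ a s → + imbalance a s ≡ (+ a -ᶻ + s) *ᶻ (+ a -ᶻ + s -ᶻ + 1)
  +-imbalance a s with a ℕP.≤? s
  ... | yes a≤s = begin
    + imbalance a s                       ≡⟨ cong (λ z → + (z * (a ∸ suc s) + (s ∸ a) * (suc s ∸ a)))
                                                  (ℕP.m≤n⇒m∸n≡0 a≤s) ⟩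
    + ((s ∸ a) * (suc s ∸ a))             ≡⟨ ℤP.pos-* (s ∸ a) (suc s ∸ a) ⟩
    + (s ∸ a) *ᶻ + (suc s ∸ a)            ≡⟨ cong₂ _*ᶻ_ (+-∸ a≤s) (+-∸ (ℕP.m≤n⇒m≤1+n a≤s)) ⟩
    (+ s -ᶻ + a) *ᶻ (+ 1 +ᶻ + s -ᶻ + a)   ≡⟨ identity (+ a) (+ s) ⟩
    (+ a -ᶻ + s) *ᶻ (+ a -ᶻ + s -ᶻ + 1)   ∎
    where
    open ≡-Reasoning
    identity : ∀ A S → (S -ᶻ A) *ᶻ (+ 1 +ᶻ S -ᶻ A) ≡ (A -ᶻ S) *ᶻ (A -ᶻ S -ᶻ + 1)
    identity = solve-∀
  ... | no a≰s = begin
    + imbalance a s                        ≡⟨ cong (λ z → + ((a ∸ s) * (a ∸ suc s) + z * (suc s ∸ a)))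
                                                   (ℕP.m≤n⇒m∸n≡0 (ℕP.<⇒≤ (ℕP.≰⇒> a≰s))) ⟩
    + ((a ∸ s) * (a ∸ suc s) + 0)          ≡⟨ cong +_ (ℕP.+-identityʳ _) ⟩
    + ((a ∸ s) * (a ∸ suc s))              ≡⟨ ℤP.pos-* (a ∸ s) (a ∸ suc s) ⟩
    + (a ∸ s) *ᶻ + (a ∸ suc s)             ≡⟨ cong₂ _*ᶻ_ (+-∸ (ℕP.<⇒≤ (ℕP.≰⇒> a≰s)))
                                                          (+-∸ (ℕP.≰⇒> a≰s)) ⟩
    (+ a -ᶻ + s) *ᶻ (+ a -ᶻ (+ 1 +ᶻ + s))  ≡⟨ identity (+ a) (+ s) ⟩
    (+ a -ᶻ + s) *ᶻ (+ a -ᶻ + s -ᶻ + 1)    ∎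
    where
    open ≡-Reasoning
    identity : ∀ A S → (A -ᶻ S) *ᶻ (A -ᶻ (+ 1 +ᶻ S)) ≡ (A -ᶻ S) *ᶻ (A -ᶻ S -ᶻ + 1)
    identity = solve-∀

  +-classPenalty : ∀ {n s a} → s < n → a ≤ n → + classPenalty n s a ≡ classPenaltyᶻ (+ n) (+ s) (+ a)
  +-classPenalty {n} {s} {a} s<n a≤n = trans (ℤP.pos-* (imbalance a s) _) (cong₂ _*ᶻ_ (+-imbalance a s)
    (trans (+-∸ (2+2s+a≤3n s<n a≤n)) (cong₂ _-ᶻ_ (ℤP.pos-* 3 n) (cong (λ z → + 2 +ᶻ z +ᶻ + a) (ℤP.pos-* 2 s)))))

  sum-chord : ∀ {n s k} (a : Fin k → ℕ) → 1 ≤ n → s < n → (∀ i → a i ≤ n) →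
    + (sum (λ i → classWeight n (a i)) + sum (λ i → classPenalty n s (a i)))
      ≡ + k *ᶻ classWeightᶻ (+ n) (+ s) +ᶻ (+ sum a -ᶻ + k *ᶻ + s) *ᶻ slopeᶻ (+ n) (+ s)
  sum-chord {n} {s} {zero} a n≥1 s<n a≤n = identity (+ s) (classWeightᶻ (+ n) (+ s)) (slopeᶻ (+ n) (+ s))
    where
    identity : ∀ S φ σ → + 0 ≡ + 0 *ᶻ φ +ᶻ (+ 0 -ᶻ + 0 *ᶻ S) *ᶻ σ
    identity = solve-∀
  sum-chord {n} {s} {suc k} a n≥1 s<n a≤n = begin
    + (classWeight n (a zero) + sum (λ i → classWeight n (a (suc i)))
       + (classPenalty n s (a zero) + sum (λ i → classPenalty n s (a (suc i)))))
      ≡⟨ interchange (+ classWeight n (a zero)) (+ sum (λ i → classWeight n (a (suc i))))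
                     (+ classPenalty n s (a zero)) (+ sum (λ i → classPenalty n s (a (suc i)))) ⟩
    (+ classWeight n (a zero) +ᶻ + classPenalty n s (a zero))
      +ᶻ + (sum (λ i → classWeight n (a (suc i))) + sum (λ i → classPenalty n s (a (suc i))))
      ≡⟨ cong₂ _+ᶻ_ (trans (cong₂ _+ᶻ_ (+-classWeight n≥1 (a≤n zero)) (+-classPenalty s<n (a≤n zero)))
                           (chord (+ n) (+ s) (+ a zero)))
                    (sum-chord (λ i → a (suc i)) n≥1 s<n (λ i → a≤n (suc i))) ⟩
    (φ +ᶻ (+ a zero -ᶻ + s) *ᶻ σ) +ᶻ (+ k *ᶻ φ +ᶻ (+ sum (λ i → a (suc i)) -ᶻ + k *ᶻ + s) *ᶻ σ)
      ≡⟨ identity (+ a zero) (+ sum (λ i → a (suc i))) (+ k) (+ s) φ σ ⟩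
    (+ 1 +ᶻ + k) *ᶻ φ +ᶻ ((+ a zero +ᶻ + sum (λ i → a (suc i))) -ᶻ (+ 1 +ᶻ + k) *ᶻ + s) *ᶻ σ ∎
    where
    open ≡-Reasoning
    φ = classWeightᶻ (+ n) (+ s)
    σ = slopeᶻ (+ n) (+ s)
    interchange : ∀ a b c d → (a +ᶻ b) +ᶻ (c +ᶻ d) ≡ (a +ᶻ c) +ᶻ (b +ᶻ d)
    interchange = solve-∀
    identity : ∀ A₀ A K S φ σ → (φ +ᶻ (A₀ -ᶻ S) *ᶻ σ) +ᶻ (K *ᶻ φ +ᶻ (A -ᶻ K *ᶻ S) *ᶻ σ)
                               ≡ (+ 1 +ᶻ K) *ᶻ φ +ᶻ ((A₀ +ᶻ A) -ᶻ (+ 1 +ᶻ K) *ᶻ S) *ᶻ σ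
    identity = solve-∀

  numerator-decomposition : ∀ {n m s t k m′ e} (a : Fin k → ℕ) → 1 ≤ m → 1 ≤ k →
    m ≡ m′ + e → n ≡ m + (s * k + t) → m′ + sum a ≡ n →
    numeratorᶻ (+ n) (+ m) (+ s) (+ t) ≡
      + (m′ * vertexWeight n (n ∸ 1) + sum (λ i → classWeight n (a i))
         + (e * apexPenalty n s + sum (λ i → classPenalty n s (a i))))
  numerator-decomposition {n} {m} {s} {t} {k} {m′} {e} a m≥1 k≥1 refl refl total = begin
    numeratorᶻ Nᶻ Mᶻ Sᶻ Tᶻ
      ≡⟨ cong (λ X → numeratorᶻ X Mᶻ Sᶻ Tᶻ) Nᶻ≡ ⟩
    numeratorᶻ (Mᶻ +ᶻ (Sᶻ *ᶻ Kᶻ +ᶻ Tᶻ)) Mᶻ Sᶻ Tᶻ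
      ≡⟨ numerator-closed-form Mᶻ Sᶻ Kᶻ Tᶻ ⟩
    Mᶻ *ᶻ vertexWeightᶻ (Mᶻ +ᶻ (Sᶻ *ᶻ Kᶻ +ᶻ Tᶻ)) ((Mᶻ +ᶻ (Sᶻ *ᶻ Kᶻ +ᶻ Tᶻ)) -ᶻ + 1)
      +ᶻ Kᶻ *ᶻ classWeightᶻ (Mᶻ +ᶻ (Sᶻ *ᶻ Kᶻ +ᶻ Tᶻ)) Sᶻ +ᶻ Tᶻ *ᶻ slopeᶻ (Mᶻ +ᶻ (Sᶻ *ᶻ Kᶻ +ᶻ Tᶻ)) Sᶻ
      ≡⟨ cong (λ X → Mᶻ *ᶻ vertexWeightᶻ X (X -ᶻ + 1) +ᶻ Kᶻ *ᶻ classWeightᶻ X Sᶻ +ᶻ Tᶻ *ᶻ slopeᶻ X Sᶻ)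
              (sym Nᶻ≡) ⟩
    Mᶻ *ᶻ h +ᶻ Kᶻ *ᶻ φ +ᶻ Tᶻ *ᶻ σ
      ≡⟨ regroup (+ m′) (+ e) Sᶻ Kᶻ Tᶻ h φ σ ⟩
    + m′ *ᶻ h +ᶻ (Kᶻ *ᶻ φ +ᶻ ((+ e +ᶻ (Sᶻ *ᶻ Kᶻ +ᶻ Tᶻ)) -ᶻ Kᶻ *ᶻ Sᶻ) *ᶻ σ) +ᶻ + e *ᶻ (h -ᶻ σ)
      ≡⟨ cong₂ (λ X Y → + m′ *ᶻ h +ᶻ X +ᶻ + e *ᶻ Y)
               (sym (trans (sum-chord a n≥1 s<n a≤n) (cong (λ A → Kᶻ *ᶻ φ +ᶻ (A -ᶻ Kᶻ *ᶻ Sᶻ) *ᶻ σ) ∑a≡)))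
               (apex-slope Nᶻ Sᶻ) ⟩
    + m′ *ᶻ h +ᶻ (+ ∑w +ᶻ + ∑p) +ᶻ + e *ᶻ apexPenaltyᶻ Nᶻ Sᶻ
      ≡⟨ regroup′ (+ m′ *ᶻ h) (+ ∑w) (+ ∑p) (+ e *ᶻ apexPenaltyᶻ Nᶻ Sᶻ) ⟩
    + m′ *ᶻ h +ᶻ + ∑w +ᶻ (+ e *ᶻ apexPenaltyᶻ Nᶻ Sᶻ +ᶻ + ∑p)
      ≡⟨ cong₂ (λ X Y → X +ᶻ + ∑w +ᶻ (Y +ᶻ + ∑p)) (sym apex-part) (sym penalty-part) ⟩
    + (m′ * vertexWeight n (n ∸ 1) + ∑w + (e * apexPenalty n s + ∑p)) ∎
    where
    open ≡-Reasoning
    Nᶻ = + n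
    Mᶻ = + m
    Sᶻ = + s
    Kᶻ = + k
    Tᶻ = + t
    h = vertexWeightᶻ Nᶻ (Nᶻ -ᶻ + 1)
    φ = classWeightᶻ Nᶻ Sᶻ
    σ = slopeᶻ Nᶻ Sᶻ
    ∑w = sum (λ i → classWeight n (a i))
    ∑p = sum (λ i → classPenalty n s (a i))
    n≥1 : 1 ≤ n
    n≥1 = ℕP.≤-trans m≥1 (ℕP.m≤m+n m (s * k + t))
    s<n : s < n
    s<n = s<m+[s*k+t] m≥1 k≥1
    a≤n : ∀ i → a i ≤ n
    a≤n i = ℕP.≤-trans (sum-single-≤ a i) (subst (sum a ≤_) total (ℕP.m≤n+m (sum a) m′))
    Nᶻ≡ : Nᶻ ≡ Mᶻ +ᶻ (Sᶻ *ᶻ Kᶻ +ᶻ Tᶻ)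
    Nᶻ≡ = cong (λ z → Mᶻ +ᶻ (z +ᶻ Tᶻ)) (ℤP.pos-* s k)
    ∑a≡ : + sum a ≡ + e +ᶻ (Sᶻ *ᶻ Kᶻ +ᶻ Tᶻ)
    ∑a≡ = trans (cong +_ (ℕP.+-cancelˡ-≡ m′ (sum a) _ (trans total (ℕP.+-assoc m′ e (s * k + t)))))
                (cong (λ z → + e +ᶻ (z +ᶻ Tᶻ)) (ℤP.pos-* s k))
    apex-part : + (m′ * vertexWeight n (n ∸ 1)) ≡ + m′ *ᶻ h
    apex-part = trans (ℤP.pos-* m′ _) (cong (+ m′ *ᶻ_)
      (trans (+-vertexWeight (n ∸ 1) n≥1) (cong (vertexWeightᶻ Nᶻ) (+-∸ n≥1))))
    penalty-part : + (e * apexPenalty n s) ≡ + e *ᶻ apexPenaltyᶻ Nᶻ Sᶻ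
    penalty-part = trans (ℤP.pos-* e _) (cong (+ e *ᶻ_) (+-apexPenalty s<n))
    regroup : ∀ M′ E S K T h φ σ → (M′ +ᶻ E) *ᶻ h +ᶻ K *ᶻ φ +ᶻ T *ᶻ σ
      ≡ M′ *ᶻ h +ᶻ (K *ᶻ φ +ᶻ ((E +ᶻ (S *ᶻ K +ᶻ T)) -ᶻ K *ᶻ S) *ᶻ σ) +ᶻ E *ᶻ (h -ᶻ σ)
    regroup = solve-∀
    regroup′ : ∀ a b c d → a +ᶻ (b +ᶻ c) +ᶻ d ≡ a +ᶻ b +ᶻ (d +ᶻ c)
    regroup′ = solve-∀

  bound-decomposition : ∀ {n m s t k m′ e} (a : Fin k → ℕ) → 1 ≤ m → 1 ≤ k →
    m ≡ m′ + e → n ≡ m + (s * k + t) → m′ + sum a ≡ n →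
    bound n m s t ≡ half (m′ * vertexWeight n (n ∸ 1) + sum (λ i → classWeight n (a i))
                          + (e * apexPenalty n s + sum (λ i → classPenalty n s (a i))))
  bound-decomposition a m≥1 k≥1 m≡ n≡ total =
    cong (ℚ._/ 2) (numerator-decomposition a m≥1 k≥1 m≡ n≡ total)

open Arithmetic using (bound-decomposition)

-- The bound for labelled graphs

-- The label profile of K_m ∨ ((k − t)K̄_s ∨ tK̄_{s+1}).
record Balanced {n k} (L : Labelling n k) (m s t : ℕ) : Set where
  field
    apexCount≡ : apexCount L ≡ m
    large : Fin k → Bool
    classSize≡ : ∀ i → classSize L i ≡ s + ind (large i)
    #large≡ : sum (λ i → ind (large i)) ≡ t

apex-exists : ∀ {n k} (L : Labelling n k) → 1 ≤ apexCount L → ∃ λ z → L z ≡ nothing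
apex-exists L apex≥1 with sum-pos⇒∃ (λ x → ind ⌊ nothing ≟ᴹ L x ⌋) apex≥1
... | z , hit = z , sym (⌊⌋-sound (nothing ≟ᴹ L z) (ind-pos hit))

module Apex {n k} (G : Graph n) (L : Labelling n k) (sat : Saturated G L) {z} (Lz≡ : L z ≡ nothing) where

  apex-adjʳ : ∀ {x} → x ≢ z → adj G x z ≡ true
  apex-adjʳ {x} x≢z rewrite sat x z | Lz≡ | ⌊⌋-false (x ≟ z) x≢z | sameClass-nothingʳ (L x) = refl

  apex-adjˡ : ∀ {y} → z ≢ y → adj G z y ≡ true
  apex-adjˡ {y} z≢y rewrite sat z y | Lz≡ | ⌊⌋-false (z ≟ y) z≢y = refl

  apex-diameter≤2 : PairSum.Diameter≤2 G
  apex-diameter≤2 x y x≢y ¬xy = z , apex-adjʳ x≢z , apex-adjˡ z≢y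
    where
    x≢z : x ≢ z
    x≢z refl with trans (sym ¬xy) (apex-adjˡ x≢y)
    ... | ()
    z≢y : z ≢ y
    z≢y refl with trans (sym ¬xy) (apex-adjʳ x≢y)
    ... | ()

module Bound {n k} (G : Graph n) (simple : Simple G) (L : Labelling n k)
             {m s t} (m≥1 : 1 ≤ m) (k≥1 : 1 ≤ k) (n≡ : n ≡ m + (s * k + t)) where
  open PairSum G
  open Degrees G L

  penalty : ℕ
  penalty = (m ∸ apexCount L) * apexPenalty n s + sum (λ i → classPenalty n s (classSize L i))

  bound-≡ : apexCount L ≤ m → bound n m s t ≡ half (capacity L + penalty)
  bound-≡ apex≤m = trans (bound-decomposition (classSize L) m≥1 k≥1 (sym (ℕP.m+[n∸m]≡n apex≤m)) n≡ (vertexCount L))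
                  (cong (λ c → half (c + penalty)) (sym (capacity-≡ L)))

  penalty≡0⇒balanced : 1 ≤ s → apexCount L ≤ m → penalty ≡ 0 → Balanced L m s t
  penalty≡0⇒balanced s≥1 apex≤m pen≡0 = balanced
    where
    s<n : s < n
    s<n = subst (s <_) (sym n≡) (s<m+[s*k+t] m≥1 k≥1)
    apex≡m : apexCount L ≡ m
    apex≡m = [ (λ m∸apex≡0 → ℕP.≤-antisym apex≤m (ℕP.m∸n≡0⇒m≤n m∸apex≡0))
             , (λ ap≡0 → ⊥-elim (ℕP.<⇒≢ (apexPenalty-pos s≥1 s<n) (sym ap≡0)))
             ]′ (ℕP.m*n≡0⇒m≡0∨n≡0 (m ∸ apexCount L) (ℕP.m+n≡0⇒m≡0 _ pen≡0))
    size<n : ∀ i → classSize L i < n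
    size<n i = subst (classSize L i <_) (vertexCount L)
      (ℕP.+-mono-≤ (subst (1 ≤_) (sym apex≡m) m≥1) (sum-single-≤ (classSize L) i))
    two-sizes : ∀ i → classSize L i ≡ s ⊎ classSize L i ≡ suc s
    two-sizes i = classPenalty≡0⇒ s<n (size<n i)
      (sum≡0⇒≡0 (λ j → classPenalty n s (classSize L j)) (ℕP.m+n≡0⇒n≡0 _ pen≡0) i)
    large : Fin k → Bool
    large i = ⌊ classSize L i ℕP.≟ suc s ⌋
    size≡ : ∀ i → classSize L i ≡ s + ind (large i)
    size≡ i = two-valued (two-sizes i)
    #large≡ : sum (λ i → ind (large i)) ≡ t
    #large≡ = ℕP.+-cancelˡ-≡ (s * k) _ _ (ℕP.+-cancelˡ-≡ m _ _ (begin
      m + (s * k + sum (λ i → ind (large i)))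
        ≡⟨ cong₂ (λ a b → a + (b + sum (λ i → ind (large i))))
                 (sym apex≡m) (trans (ℕP.*-comm s k) (sym (sum-const k s))) ⟩
      apexCount L + (sum {k} (λ _ → s) + sum (λ i → ind (large i)))
        ≡⟨ cong (apexCount L +_) (sym (trans (sum-cong-≗ size≡) (∑-distrib-+ (λ _ → s) (λ i → ind (large i))))) ⟩
      apexCount L + sum (classSize L)
        ≡⟨ trans (vertexCount L) n≡ ⟩
      m + (s * k + t) ∎))
      where open ≡-Reasoning
    balanced : Balanced L m s t
    balanced = record { apexCount≡ = apex≡m ; large = large ; classSize≡ = size≡ ; #large≡ = #large≡ }

  balanced⇒penalty≡0 : Balanced L m s t → penalty ≡ 0
  balanced⇒penalty≡0 bal = cong₂ _+_
    (cong (_* apexPenalty n s) (trans (cong (m ∸_) apexCount≡) (ℕP.n∸n≡0 m)))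
    (trans (sum-cong-≗ (λ i → trans (cong (classPenalty n s) (classSize≡ i)) (classPenalty-balanced n s (large i))))
           (sum-zero k))
    where open Balanced bal

  rdd-≤-half-degreeWeight : RDD G ≤ℚ half (degreeWeight G)
  rdd-≤-half-degreeWeight = subst (λ w → RDD G ≤ℚ half w) (pairSum-≡ simple) RDD-≤

  module _ (proper : Proper G L) (apex≤m : apexCount L ≤ m) where

    rdd-≤-bound : RDD G ≤ℚ bound n m s t
    rdd-≤-bound = ℚP.≤-trans rdd-≤-half-degreeWeight (subst (half (degreeWeight G) ≤ℚ_) (sym (bound-≡ apex≤m))
      (half-mono-≤ (ℕP.≤-trans (degreeWeight-≤-capacity proper) (ℕP.m≤m+n (capacity L) penalty))))

    rdd≡bound⇒tight : RDD G ≡ bound n m s t → degreeWeight G ≡ capacity L × penalty ≡ 0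
    rdd≡bound⇒tight rdd≡ = ℕP.≤-antisym (degreeWeight-≤-capacity proper) (ℕP.≤-trans (ℕP.m≤m+n _ _) cap+pen≤dw)
                         , ℕP.n≤0⇒n≡0 (ℕP.+-cancelˡ-≤ (capacity L) penalty 0
                             (ℕP.≤-trans cap+pen≤dw (ℕP.≤-trans (degreeWeight-≤-capacity proper)
                               (ℕP.≤-reflexive (sym (ℕP.+-identityʳ (capacity L)))))))
      where
      cap+pen≤dw : capacity L + penalty ≤ degreeWeight G
      cap+pen≤dw = half-cancel-≤ (subst (_≤ℚ half (degreeWeight G)) (trans rdd≡ (bound-≡ apex≤m)) rdd-≤-half-degreeWeight)

    rdd≡bound⇒saturated-balanced : 1 ≤ s → RDD G ≡ bound n m s t → Saturated G L × Balanced L m s t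
    rdd≡bound⇒saturated-balanced s≥1 rdd≡ =
      degreeWeight-≡⇒saturated proper (proj₁ tight) , penalty≡0⇒balanced s≥1 apex≤m (proj₂ tight)
      where tight = rdd≡bound⇒tight rdd≡

  saturated-balanced⇒rdd≡bound : Saturated G L → Balanced L m s t → RDD G ≡ bound n m s t
  saturated-balanced⇒rdd≡bound sat bal = begin
    RDD G                            ≡⟨ RDD-≡ (Apex.apex-diameter≤2 G L sat (proj₂ apex)) ⟩
    half pairSum                     ≡⟨ cong half (pairSum-≡ simple) ⟩
    half (degreeWeight G)            ≡⟨ cong half (trans (degreeWeight-≡-capacity sat) (sym (ℕP.+-identityʳ _))) ⟩
    half (capacity L + 0)            ≡⟨ cong (λ p → half (capacity L + p)) (sym (balanced⇒penalty≡0 bal)) ⟩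
    half (capacity L + penalty)      ≡⟨ sym (bound-≡ (ℕP.≤-reflexive apexCount≡)) ⟩
    bound n m s t                    ∎
    where
    open ≡-Reasoning
    open Balanced bal
    apex : ∃ λ z → L z ≡ nothing
    apex = apex-exists L (subst (1 ≤_) (sym apexCount≡) m≥1)


-- Deletion labellings and the extremal graph

deletionLabelling : ∀ {n k} → Subset n → (Fin n → Fin k) → Labelling n k
deletionLabelling S c x = if lookup S x then nothing else just (c x)

apexCount-deletion : ∀ {n k} (S : Subset n) (c : Fin n → Fin k) → apexCount (deletionLabelling S c) ≡ ∣ S ∣
apexCount-deletion S c = trans (sum-cong-≗ deleted) (sym (∣∣-sum S))
  where
  deleted : ∀ x → ind ⌊ nothing ≟ᴹ deletionLabelling S c x ⌋ ≡ ind (lookup S x)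
  deleted x with lookup S x
  ... | true = refl
  ... | false = refl
  ∣∣-sum : ∀ {n} (S : Subset n) → ∣ S ∣ ≡ sum (λ x → ind (lookup S x))
  ∣∣-sum [] = refl
  ∣∣-sum (true ∷ S) = cong suc (∣∣-sum S)
  ∣∣-sum (false ∷ S) = ∣∣-sum S

deletion-proper : ∀ {n k} (G : Graph n) → Simple G → (S : Subset n) (c : Fin n → Fin k) →
  (∀ x y → x ∉ S → y ∉ S → T (adj G x y) → c x ≢ c y) → Proper G (deletionLabelling S c)
deletion-proper G simple S c colouring x y xy
  rewrite ⌊⌋-false (x ≟ y) (PairSum.loopless G simple xy) with lookup S x in Sx | lookup S y in Sy
... | true | _ = refl
... | false | true = refl
... | false | false =
  cong not (⌊⌋-false (c x ≟ c y) (colouring x y (kept Sx) (kept Sy) (subst T (sym xy) _)))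
  where
  kept : ∀ {z} → lookup S z ≡ false → z ∉ S
  kept Sz≡ z∈S with trans (sym ([]=⇒lookup z∈S)) Sz≡
  ... | ()

saturated-cong : ∀ {n k} {G : Graph n} {L L′ : Labelling n k} →
  (∀ x → L x ≡ L′ x) → Saturated G L → Saturated G L′
saturated-cong L≗L′ sat x y =
  trans (sat x y) (cong₂ (λ l l′ → not ⌊ x ≟ y ⌋ ∧ not (sameClass l l′)) (L≗L′ x) (L≗L′ y))

saturated-map : ∀ {n k k′} {G : Graph n} {L : Labelling n k} {f : Fin k → Fin k′} →
  (∀ {i j} → f i ≡ f j → i ≡ j) → Saturated G L → Saturated G (Maybe.map f ∘ L)
saturated-map {L = L} f-inj sat x y =
  trans (sat x y) (cong (λ b → not ⌊ x ≟ y ⌋ ∧ not b) (sym (sameClass-map f-inj (L x) (L y))))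

saturated-K : ∀ {k} m → Saturated {k = k} (K m) (λ _ → nothing)
saturated-K m x y = sym (∧-identityʳ (not ⌊ x ≟ y ⌋))

saturated-edgeless : ∀ {k} b (c : Fin k) → Saturated (edgeless b) (λ _ → just c)
saturated-edgeless b c x y rewrite ⌊⌋-true (c ≟ c) refl = sym (∧-zeroʳ (not ⌊ x ≟ y ⌋))

saturated-join : ∀ {a b k} {G : Graph a} {H : Graph b} {L : Labelling a k} {M : Labelling b k} →
  Saturated G L → Saturated H M → (∀ x y → sameClass (L x) (M y) ≡ false) →
  Saturated (join G H) (λ u → [ L , M ]′ (splitAt a u))
saturated-join {a} {L = L} {M} satG satH disjoint u v
  rewrite ⌊≟⌋-splitAt a u v with splitAt a u | splitAt a v
... | inj₁ x | inj₁ y = trans (satG x y) (cong (λ e → not e ∧ not (sameClass (L x) (L y)))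
                                               (sym (⌊⌋-map′ (cong inj₁) SumP.inj₁-injective (x ≟ y))))
... | inj₂ x | inj₂ y = trans (satH x y) (cong (λ e → not e ∧ not (sameClass (M x) (M y)))
                                               (sym (⌊⌋-map′ (cong inj₂) SumP.inj₂-injective (x ≟ y))))
... | inj₁ x | inj₂ y = sym (cong not (disjoint x y))
... | inj₂ x | inj₁ y = sym (cong not (trans (sameClass-sym (M x) (L y)) (disjoint y x)))

quotient-splitAt : ∀ {r} b (u : Fin (suc r * b)) →
  quotient {suc r} b u ≡ [ (λ _ → zero) , (λ y → suc (quotient {r} b y)) ]′ (splitAt b u)
quotient-splitAt b u with splitAt b u
... | inj₁ _ = refl
... | inj₂ _ = refl

saturated-joinPow : ∀ r b → Saturated (joinPow r (edgeless b)) (λ u → just (quotient {r} b u))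
saturated-joinPow zero b ()
saturated-joinPow (suc r) b = saturated-cong (λ u → trans (sym (SumP.[,]-∘ just (splitAt b u)))
                                                         (cong just (sym (quotient-splitAt b u))))
  (saturated-join (saturated-edgeless b (zero {r})) (saturated-map FinP.suc-injective (saturated-joinPow r b)) (λ _ _ → refl))

quotient-fibre : ∀ r b (i : Fin r) → Counting.count _≟_ (quotient {r} b) i ≡ b
quotient-fibre (suc r) b i = begin
  count (quotient {suc r} b) i
    ≡⟨ sum-cong-≗ (λ u → cong (λ j → ind ⌊ i ≟ j ⌋) (quotient-splitAt b u)) ⟩
  count (λ u → [ (λ _ → zero) , (λ y → suc (quotient {r} b y)) ]′ (splitAt b u)) i
    ≡⟨ count-splitAt b (λ _ → zero) (λ y → suc (quotient {r} b y)) i ⟩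
  count {b} (λ _ → zero) i + count (λ y → suc (quotient {r} b y)) i
    ≡⟨ by-index i ⟩
  b ∎
  where
  open ≡-Reasoning
  open Counting _≟_
  by-index : ∀ i → count {b} (λ _ → zero) i + count (λ y → suc (quotient {r} b y)) i ≡ b
  by-index zero = trans (cong₂ _+_ (trans (sum-const b 1) (ℕP.*-identityʳ b))
    (count-map-∉ _≟_ {f = suc} {v = zero} (λ _ ()) (quotient {r} b))) (ℕP.+-identityʳ b)
  by-index (suc i) = trans (cong (_+ count (λ y → suc (quotient {r} b y)) (suc i)) (sum-zero b))
    (trans (count-map _≟_ _≟_ {f = suc} FinP.suc-injective (quotient {r} b) i) (quotient-fibre r b i))

module Extremal (m k s t : ℕ) where

  n₁ n₂ : ℕ
  n₁ = (k ∸ t) * s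
  n₂ = t * suc s

  smallPart : Fin (k ∸ t) → Maybe (Fin ((k ∸ t) + t))
  smallPart i = just (i ↑ˡ t)

  largePart : Fin t → Maybe (Fin ((k ∸ t) + t))
  largePart i = just ((k ∸ t) ↑ʳ i)

  smallPart-injective : ∀ {i j} → smallPart i ≡ smallPart j → i ≡ j
  smallPart-injective = FinP.↑ˡ-injective t _ _ ∘ MaybeP.just-injective

  largePart-injective : ∀ {i j} → largePart i ≡ largePart j → i ≡ j
  largePart-injective = FinP.↑ʳ-injective (k ∸ t) _ _ ∘ MaybeP.just-injective

  smallPart≢largePart : ∀ i j → smallPart i ≢ largePart j
  smallPart≢largePart i j eq
    with trans (sym (FinP.splitAt-↑ˡ (k ∸ t) i t))
               (trans (cong (splitAt (k ∸ t)) (MaybeP.just-injective eq)) (FinP.splitAt-↑ʳ (k ∸ t) t j))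
  ... | ()

  -- `quotient b` sends a vertex of `joinPow r (edgeless b)` to the copy of `edgeless b` containing it.
  parts : Labelling (n₁ + n₂) ((k ∸ t) + t)
  parts w = [ smallPart ∘ quotient {k ∸ t} s , largePart ∘ quotient {t} (suc s) ]′ (splitAt n₁ w)

  labelling : Labelling (m + (n₁ + n₂)) ((k ∸ t) + t)
  labelling u = [ (λ _ → nothing) , parts ]′ (splitAt m u)

  saturated : Saturated (extremal m k s t) labelling
  saturated = saturated-join (saturated-K {k = (k ∸ t) + t} m)
    (saturated-join (saturated-map (FinP.↑ˡ-injective t _ _) (saturated-joinPow (k ∸ t) s))
                    (saturated-map (FinP.↑ʳ-injective (k ∸ t) _ _) (saturated-joinPow t (suc s)))
                    (λ x y → ⌊⌋-false (quotient {k ∸ t} s x ↑ˡ t ≟ (k ∸ t) ↑ʳ quotient {t} (suc s) y)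
                                      (smallPart≢largePart _ _ ∘ cong just)))
    (λ _ _ → refl)

  open Counting (_≟ᴹ_ {(k ∸ t) + t})

  labelCount-parts : ∀ l → labelCount labelling l ≡
    count {m} (λ _ → nothing) l + (count (smallPart ∘ quotient {k ∸ t} s) l + count (largePart ∘ quotient {t} (suc s)) l)
  labelCount-parts l = trans (count-splitAt m (λ _ → nothing) parts l)
    (cong (count {m} (λ _ → nothing) l +_)
          (count-splitAt n₁ (smallPart ∘ quotient {k ∸ t} s) (largePart ∘ quotient {t} (suc s)) l))

  apexCount≡m : apexCount labelling ≡ m
  apexCount≡m = trans (labelCount-parts nothing) (trans
    (cong₂ _+_ (trans (sum-const m 1) (ℕP.*-identityʳ m))
               (cong₂ _+_ (count-map-∉ _≟ᴹ_ {f = smallPart} {v = nothing} (λ _ ()) (quotient {k ∸ t} s))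
                          (count-map-∉ _≟ᴹ_ {f = largePart} {v = nothing} (λ _ ()) (quotient {t} (suc s)))))
    (ℕP.+-identityʳ m))

  classSize-small : ∀ i → classSize labelling (i ↑ˡ t) ≡ s
  classSize-small i = trans (labelCount-parts (smallPart i)) (trans
    (cong₂ _+_ (sum-zero m)
      (cong₂ _+_ (trans (count-map _≟_ _≟ᴹ_ smallPart-injective (quotient {k ∸ t} s) i) (quotient-fibre (k ∸ t) s i))
                 (count-map-∉ _≟ᴹ_ {f = largePart} (smallPart≢largePart i) (quotient {t} (suc s)))))
    (ℕP.+-identityʳ s))

  classSize-large : ∀ i → classSize labelling ((k ∸ t) ↑ʳ i) ≡ suc s
  classSize-large i = trans (labelCount-parts (largePart i))
    (cong₂ _+_ (sum-zero m)
      (cong₂ _+_ (count-map-∉ _≟ᴹ_ {f = smallPart} (λ j → smallPart≢largePart j i ∘ sym) (quotient {k ∸ t} s))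
                 (trans (count-map _≟_ _≟ᴹ_ largePart-injective (quotient {t} (suc s)) i) (quotient-fibre t (suc s) i))))

  balanced : Balanced labelling m s t
  balanced = record { apexCount≡ = apexCount≡m ; large = isLarge ; classSize≡ = size≡ ; #large≡ = #large≡ }
    where
    isLarge : Fin ((k ∸ t) + t) → Bool
    isLarge j = [ (λ _ → false) , (λ _ → true) ]′ (splitAt (k ∸ t) j)
    joined : ∀ {j z} → splitAt (k ∸ t) j ≡ z → j ≡ Fin.join (k ∸ t) t z
    joined {j} eq = trans (sym (FinP.join-splitAt (k ∸ t) t j)) (cong (Fin.join (k ∸ t) t) eq)
    size≡ : ∀ j → classSize labelling j ≡ s + ind (isLarge j)
    size≡ j with splitAt (k ∸ t) j in eq
    ... | inj₁ i = trans (cong (classSize labelling) (joined eq)) (trans (classSize-small i) (sym (ℕP.+-identityʳ s)))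
    ... | inj₂ i = trans (cong (classSize labelling) (joined eq)) (trans (classSize-large i) (ℕP.+-comm 1 s))
    #large≡ : sum (λ j → ind (isLarge j)) ≡ t
    #large≡ = trans (sum-splitAt (k ∸ t) (λ z → ind ([ (λ _ → false) , (λ _ → true) ]′ z)))
                    (cong₂ _+_ (sum-zero (k ∸ t)) (trans (sum-const t 1) (ℕP.*-identityʳ t)))

-- Isomorphisms

allowed-∘ : ∀ {n N k} (M : Labelling N k) {f : Fin n → Fin N} → (∀ {x y} → f x ≡ f y → x ≡ y) →
  ∀ x y → allowed M (f x) (f y) ≡ allowed (M ∘ f) x y
allowed-∘ M {f} f-inj x y =
  cong (λ b → not b ∧ not (sameClass (M (f x)) (M (f y)))) (⌊≟⌋-injective _≟_ _≟_ f-inj x y)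

module _ {n N} {G : Graph n} {H : Graph N} (iso : G ≅ H) where
  open _≅_ iso
  open Bijection bij using (to; injective)

  saturated-pullback : ∀ {k} {M : Labelling N k} → Saturated H M → Saturated G (M ∘ to)
  saturated-pullback {M = M} sat x y =
    trans (sym (preserves x y)) (trans (sat (to x) (to y)) (allowed-∘ M injective x y))

  labelCount-pullback : ∀ {k} (M : Labelling N k) l → labelCount (M ∘ to) l ≡ labelCount M l
  labelCount-pullback M = Counting.count-permute _≟ᴹ_ (⤖⇒↔ bij) M

  balanced-pullback : ∀ {k} {M : Labelling N k} {m s t} → Balanced M m s t → Balanced (M ∘ to) m s t
  balanced-pullback {M = M} bal = record
    { apexCount≡ = trans (labelCount-pullback M nothing) apexCount≡
    ; large = large
    ; classSize≡ = λ i → trans (labelCount-pullback M (just i)) (classSize≡ i)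
    ; #large≡ = #large≡
    }
    where open Balanced bal

saturated⇒≅ : ∀ {n N k} {G : Graph n} {H : Graph N} {L : Labelling n k} {M : Labelling N k} →
  Saturated G L → Saturated H M → (π : Permutation n N) → (∀ x → M (π ⟨$⟩ʳ x) ≡ L x) → G ≅ H
saturated⇒≅ {G = G} {H} {L} {M} satG satH π labels = record { bij = ↔⇒⤖ π ; preserves = preserves }
  where
  preserves : ∀ x y → adj H (π ⟨$⟩ʳ x) (π ⟨$⟩ʳ y) ≡ adj G x y
  preserves x y = begin
    adj H (π ⟨$⟩ʳ x) (π ⟨$⟩ʳ y)    ≡⟨ satH _ _ ⟩
    allowed M (π ⟨$⟩ʳ x) (π ⟨$⟩ʳ y) ≡⟨ allowed-∘ M (Bijection.injective (↔⇒⤖ π)) x y ⟩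
    allowed (M ∘ (π ⟨$⟩ʳ_)) x y
      ≡⟨ cong₂ (λ l l′ → not ⌊ x ≟ y ⌋ ∧ not (sameClass l l′)) (labels x) (labels y) ⟩
    allowed L x y                   ≡⟨ satG x y ⟨
    adj G x y                       ∎
    where open ≡-Reasoning

module _ {k} (β : Fin k → Bool) where
  open Counting BoolP._≟_

  count-true : count β true ≡ sum (λ i → ind (β i))
  count-true = sum-cong-≗ λ i → by-value (β i)
    where
    by-value : ∀ b → ind ⌊ true BoolP.≟ b ⌋ ≡ ind b
    by-value true = refl
    by-value false = refl

  count-false : count β false ≡ k ∸ sum (λ i → ind (β i))
  count-false = trans (sym (ℕP.m+n∸n≡m _ (sum (λ i → ind (β i))))) (cong (_∸ sum (λ i → ind (β i))) (begin
    count β false + sum (λ i → ind (β i))   ≡⟨ ∑-distrib-+ (λ i → ind ⌊ false BoolP.≟ β i ⌋) (λ i → ind (β i)) ⟨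
    sum (λ i → ind ⌊ false BoolP.≟ β i ⌋ + ind (β i))  ≡⟨ sum-cong-≗ (λ i → by-value (β i)) ⟩
    sum {k} (λ _ → 1)                        ≡⟨ trans (sum-const k 1) (ℕP.*-identityʳ k) ⟩
    k                                        ∎))
    where
    open ≡-Reasoning
    by-value : ∀ b → ind ⌊ false BoolP.≟ b ⌋ + ind b ≡ 1
    by-value true = refl
    by-value false = refl

count-from-trues : ∀ {k} (β γ : Fin k → Bool) → sum (λ i → ind (β i)) ≡ sum (λ i → ind (γ i)) →
  ∀ v → Counting.count BoolP._≟_ β v ≡ Counting.count BoolP._≟_ γ v
count-from-trues β γ trues true = trans (count-true β) (trans trues (sym (count-true γ)))
count-from-trues {k} β γ trues false = trans (count-false β) (trans (cong (k ∸_) trues) (sym (count-false γ)))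

-- First the parts of size s + 1 are matched by a permutation of the part indices, then the vertices
-- are matched label by label.
balanced⇒≅ : ∀ {n N k k′ m s t} {G : Graph n} {H : Graph N} {L : Labelling n k} {M : Labelling N k′} →
  Saturated G L → Balanced L m s t → Saturated H M → Balanced M m s t → k ≡ k′ → G ≅ H
balanced⇒≅ {k = k} {s = s} {L = L} {M} satG balL satH balM refl =
  saturated⇒≅ {M = M} (saturated-map {L = L} σ-injective satG) satH (proj₁ matching) (proj₂ matching)
  where
  module BL = Balanced balL
  module BM = Balanced balM
  classes = Counting.permutation-from-counts BoolP._≟_ BL.large BM.large
    (count-from-trues BL.large BM.large (trans BL.#large≡ (sym BM.#large≡)))
  σ = proj₁ classes
  σ-injective : ∀ {i j} → σ ⟨$⟩ʳ i ≡ σ ⟨$⟩ʳ j → i ≡ j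
  σ-injective = Bijection.injective (↔⇒⤖ σ)
  L′ : Labelling _ k
  L′ = Maybe.map (σ ⟨$⟩ʳ_) ∘ L
  relabel : ∀ l → labelCount L′ (Maybe.map (σ ⟨$⟩ʳ_) l) ≡ labelCount L l
  relabel = count-map _≟ᴹ_ _≟ᴹ_ (MaybeP.map-injective σ-injective) L
  counts : ∀ l → labelCount L′ l ≡ labelCount M l
  counts nothing = trans (relabel nothing) (trans BL.apexCount≡ (sym BM.apexCount≡))
  counts (just j) = begin
    labelCount L′ (just j)                          ≡⟨ cong (λ i → labelCount L′ (just i)) (Perm.inverseʳ σ) ⟨
    labelCount L′ (just (σ ⟨$⟩ʳ (σ ⟨$⟩ˡ j)))        ≡⟨ relabel (just (σ ⟨$⟩ˡ j)) ⟩
    classSize L (σ ⟨$⟩ˡ j)                          ≡⟨ BL.classSize≡ (σ ⟨$⟩ˡ j) ⟩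
    s + ind (BL.large (σ ⟨$⟩ˡ j))                   ≡⟨ cong (λ b → s + ind b) (proj₂ classes (σ ⟨$⟩ˡ j)) ⟨
    s + ind (BM.large (σ ⟨$⟩ʳ (σ ⟨$⟩ˡ j)))          ≡⟨ cong (λ i → s + ind (BM.large i)) (Perm.inverseʳ σ) ⟩
    s + ind (BM.large j)                            ≡⟨ BM.classSize≡ j ⟨
    labelCount M (just j)                           ∎
    where open ≡-Reasoning
  matching = Counting.permutation-from-counts _≟ᴹ_ L′ M counts

s≥1 : ∀ {k n m s t} → m + k ≤ n → n ≡ m + (s * k + t) → t < k → 1 ≤ s
s≥1 {k} {m = m} {zero} {t} m+k≤n refl t<k = ⊥-elim (ℕP.<-irrefl refl (ℕP.<-≤-trans (ℕP.+-monoʳ-< m t<k) m+k≤n))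
s≥1 {s = suc _} _ _ _ = s≤s z≤n

theorem4p3 : (k n m s t : ℕ) → 1 ≤ k → 1 ≤ m → m + k ≤ n →
  n ≡ m + (s * k + t) → t < k →
  (G : Graph n) → Simple G → Connected G → VkAtMost k m G →
  (RDD G ≤ℚ bound n m s t) × ((RDD G ≡ bound n m s t) ⇔ (G ≅ extremal m k s t))
theorem4p3 k n m s t k≥1 m≥1 m+k≤n n≡ t<k G simple _ (S , ∣S∣≤m , c , colouring) =
  rdd-≤-bound proper apex≤m , mk⇔ extremal-of-equality equality-of-extremal
  where
  L = deletionLabelling S c
  open Bound G simple L {m} {s} {t} m≥1 k≥1 n≡
  proper = deletion-proper G simple S c colouring
  apex≤m = subst (_≤ m) (sym (apexCount-deletion S c)) ∣S∣≤m
  module E = Extremal m k s t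
  k≡ : k ∸ t + t ≡ k
  k≡ = ℕP.m∸n+n≡m (ℕP.<⇒≤ t<k)

  extremal-of-equality : RDD G ≡ bound n m s t → G ≅ extremal m k s t
  extremal-of-equality rdd≡ = balanced⇒≅ (proj₁ tight) (proj₂ tight) E.saturated E.balanced (sym k≡)
    where tight = rdd≡bound⇒saturated-balanced proper apex≤m (s≥1 m+k≤n n≡ t<k) rdd≡

  equality-of-extremal : G ≅ extremal m k s t → RDD G ≡ bound n m s t
  equality-of-extremal iso = Bound.saturated-balanced⇒rdd≡bound G simple L′ {m} {s} {t} m≥1
    (subst (1 ≤_) (sym k≡) k≥1) (subst (λ k′ → n ≡ m + (s * k′ + t)) (sym k≡) n≡) sat bal
    where
    L′ = E.labelling ∘ Bijection.to (_≅_.bij iso)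
    sat = saturated-pullback iso {M = E.labelling} E.saturated
    bal = balanced-pullback iso {M = E.labelling} E.balanced
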